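{- Let $R_3=\{(a,b): a,b\in\{0,1,2\}\}\cup\{(3,3)\}$ and $R_4=\{(0,0)\}\cup\{(a,b): a,b\in\{1,2,3\}\}$. Then the four mesh patterns $(123,R_3)$, $(321,R_3)$, $(123,R_4)$, $(321,R_4)$ are Wilf-equivalent, i.e., for every $n\ge 1$ the number of permutations in $S_n$ avoiding each of them is the same.
   Context: $S_n$ is the set of permutations of $\{1,\dots,n\}$. A mesh pattern of length $k$ is a pair $(\tau,R)$ with $\tau\in S_k$ and $R\subseteq\{0,\dots,k\}^2$; the element $(a,b)\in R$ is the "shaded box" whose corners are $(a,b),(a,b+1),(a+1,b+1),(a+1,b)$ in the plot of $\tau$ (first coordinate = position, second = value). An occurrence of $(\tau,R)$ in $\pi=\pi_1\cdots\pi_n\in S_n$ is a tuple of indices $i_1<\dots<i_k$ such that $\pi_{i_1}\cdots\pi_{i_k}$ is order-isomorphic to $\tau$ and, setting $i_0=0$, $i_{k+1}=n+1$, letting $v_1<\dots<v_k$ be the values $\pi_{i_1},\dots,\pi_{i_k}$ in increasing order and $v_0=0$, $v_{k+1}=n+1$, for every $(a,b)\in R$ there is no index $m$ with $i_a<m<i_{a+1}$ and $v_b<\pi_m<v_{b+1}$. A permutation avoids a mesh pattern if it has no occurrence of it. -}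

module Defs where

open import Data.Nat using (ℕ; zero; suc; _+_; _∸_; _<ᵇ_; _≡ᵇ_)
open import Data.Bool using (Bool; true; false; _∧_; _∨_; not)
open import Data.List using (List; []; _∷_; map; length; filterᵇ; concatMap)
open import Data.Bool.ListAction using (all; any)
open import Data.List.Base using (applyUpTo)
open import Data.Product using (_×_; _,_; proj₁; proj₂)

-- Permutations of {1,…,n} are represented in one-line notation as a
-- list of naturals π₁ ⋯ πₙ.

range1 : ℕ → List ℕ
range1 n = applyUpTo suc n

words : List ℕ → ℕ → List (List ℕ)
words xs zero    = [] ∷ []
words xs (suc k) = concatMap (λ x → map (x ∷_) (words xs k)) xs

elem : ℕ → List ℕ → Bool
elem x []       = false
elem x (y ∷ ys) = (x ≡ᵇ y) ∨ elem x ys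

distinct : List ℕ → Bool
distinct []       = true
distinct (x ∷ xs) = not (elem x xs) ∧ distinct xs

S : ℕ → List (List ℕ)
S n = filterᵇ distinct (words (range1 n) n)

-- Mesh patterns (τ , R): τ a permutation of {1..k} in one-line notation,
-- R a list of shaded boxes (a , b) with 0 ≤ a , b ≤ k.

record MeshPattern : Set where
  constructor mesh
  field
    τ : List ℕ
    R : List (ℕ × ℕ)

-- 1-indexed access with default 0 (never used out of range below)
at : List ℕ → ℕ → ℕ
at []       _             = 0
at (x ∷ xs) zero          = 0
at (x ∷ xs) (suc zero)    = x
at (x ∷ xs) (suc (suc j)) = at xs (suc j)

incTuples : ℕ → ℕ → ℕ → List (List ℕ)
incTuples n lo zero    = [] ∷ []
incTuples n lo (suc k) =
  concatMap (λ i → if' (lo <ᵇ i) (map (i ∷_) (incTuples n i k)) []) (range1 n)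
  where
  if' : Bool → List (List ℕ) → List (List ℕ) → List (List ℕ)
  if' true  a _ = a
  if' false _ b = b

orderIso : List ℕ → List ℕ → Bool
orderIso σ τ =
  (length σ ≡ᵇ length τ) ∧
  all (λ p → all (λ q → (at σ p <ᵇ at σ q) ≡ᴮ (at τ p <ᵇ at τ q))
                 (range1 (length τ)))
      (range1 (length τ))
  where
  _≡ᴮ_ : Bool → Bool → Bool
  true  ≡ᴮ b = b
  false ≡ᴮ b = not b

insert : ℕ → List ℕ → List ℕ
insert x []       = x ∷ []
insert x (y ∷ ys) with x <ᵇ y
... | true  = x ∷ y ∷ ys
... | false = y ∷ insert x ys

isort : List ℕ → List ℕ
isort []       = []
isort (x ∷ xs) = insert x (isort xs)

-- boundary sequences: i₀ = 0, i_{k+1} = n+1; v₀ = 0, v_{k+1} = n+1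
-- (accessed via index j ∈ {0,…,k+1})
bnd : ℕ → List ℕ → ℕ → ℕ
bnd n xs zero    = 0
bnd n xs (suc j) with (suc j) ≡ᵇ suc (length xs)
... | true  = suc n
... | false = at xs (suc j)

boxEmpty : List ℕ → List ℕ → ℕ × ℕ → Bool
boxEmpty π is (a , b) =
  not (any (λ m → (bnd n is a <ᵇ m) ∧ (m <ᵇ bnd n is (suc a)) ∧
                  (bnd n vs b <ᵇ at π m) ∧ (at π m <ᵇ bnd n vs (suc b)))
           (range1 n))
  where
  n  = length π
  vs = isort (map (at π) is)

isOccurrence : MeshPattern → List ℕ → List ℕ → Bool
isOccurrence (mesh τ R) π is =
  orderIso (map (at π) is) τ ∧ all (boxEmpty π is) R

contains : MeshPattern → List ℕ → Bool
contains p π =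
  any (isOccurrence p π) (incTuples (length π) 0 (length (MeshPattern.τ p)))

avoids : MeshPattern → List ℕ → Bool
avoids p π = not (contains p π)

countAvoiders : MeshPattern → ℕ → ℕ
countAvoiders p n =
  length (filterᵇ (avoids p) (S n))

R₃ : List (ℕ × ℕ)
R₃ = concatMap (λ a → map (a ,_) (0 ∷ 1 ∷ 2 ∷ [])) (0 ∷ 1 ∷ 2 ∷ [])
     Data.List.++ ((3 , 3) ∷ [])

R₄ : List (ℕ × ℕ)
R₄ = (0 , 0) ∷ concatMap (λ a → map (a ,_) (1 ∷ 2 ∷ 3 ∷ [])) (1 ∷ 2 ∷ 3 ∷ [])

p123 : List ℕ
p123 = 1 ∷ 2 ∷ 3 ∷ []

p321 : List ℕ
p321 = 3 ∷ 2 ∷ 1 ∷ []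

-- Write σ = reverse π and take its Lehmer code, whose i-th entry counts the later entries of
-- σ below σᵢ. An occurrence of (123,R₃) in π is an entry s of σ that exceeds every earlier
-- entry and is followed by exactly two smaller entries, appearing in decreasing order. An
-- occurrence of (321,R₃) is an entry s followed by entries b < c with s < b, all other later
-- entries above c and all earlier entries below c. Both are detected by a left-to-right scan
-- of the code whose state, the number of remaining entries below the running maximum, enters
-- the tests only through whether it is at most 2. The involution `toggle` permutes each code
-- value in {0,1,2} according to the order of the two smallest later entries; this reverses
-- that order at every position and turns the first scan into the second, so the avoiders of
-- (123,R₃) and (321,R₃) are equinumerous. Rotating the plot by 180° fixes 123 and 321 and
-- carries R₃ to R₄, which gives the other two equalities.

module Submission where

open import Defs
open import Data.Bool using (Bool; true; false; T; not; _∧_; _∨_; if_then_else_)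
open import Data.Bool.ListAction using (all)
open import Data.Bool.Properties using (T-≡; T-∧; T-∨)
open import Data.Empty using (⊥-elim)
open import Data.List using (List; []; _∷_; _++_; _∷ʳ_; length; map; filter; filterᵇ; foldr; drop; take; reverse)
open import Data.List.Properties
  using ( length-++; length-map; length-filter; length-applyUpTo; length-reverse; ∷-injective; ∷-injectiveʳ
        ; filter-++; filter-none; filter-all; filter-accept; filter-reject; filter-notAll
        ; ++-assoc; ++-identityʳ; map-++; map-∘; map-id-local; drop-drop
        ; reverse-++; unfold-reverse; reverse-involutive; reverse-map )
open import Data.List.Membership.Propositional using (_∈_; _∉_; find; lose)
open import Data.List.Membership.Propositional.Properties
  using ( ∈-map⁺; ∈-map⁻; ∈-concatMap⁺; ∈-concatMap⁻; ∈-applyUpTo⁺; ∈-applyUpTo⁻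
        ; ∈-filter⁺; ∈-filter⁻; ∈-++⁺ˡ; ∈-++⁺ʳ )
open import Data.List.Membership.Propositional.Properties.WithK using (unique∧set⇒bag)
open import Data.List.Membership.DecPropositional using () renaming (_∈?_ to ∈?)
open import Data.List.Relation.Binary.BagAndSetEquality using (∼bag⇒↭)
open import Data.List.Relation.Binary.Disjoint.Propositional using (Disjoint)
open import Data.List.Relation.Binary.Permutation.Propositional using (↭-sym)
open import Data.List.Relation.Binary.Permutation.Propositional.Properties using (↭-length; All-resp-↭; ↭-reverse)
open import Data.List.Relation.Binary.Subset.Propositional using (_⊆_)
open import Data.List.Relation.Unary.All as All using (All; []; _∷_)
import Data.List.Relation.Unary.All.Properties as All
open import Data.List.Relation.Unary.All.Properties using (All¬⇒¬Any; ¬Any⇒All¬)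
open import Data.List.Relation.Unary.AllPairs using ([]; _∷_)
import Data.List.Relation.Unary.AllPairs as AllPairs
import Data.List.Relation.Unary.AllPairs.Properties as AllPairs
open import Data.List.Relation.Unary.Any using (Any; here; there)
import Data.List.Relation.Unary.Any.Properties as Any
open import Data.List.Relation.Unary.Any.Properties using (any⁺; any⁻)
open import Data.List.Relation.Unary.Unique.Propositional using (Unique)
import Data.List.Relation.Unary.Unique.Propositional.Properties as Unique
open import Data.Nat
  using (ℕ; zero; suc; pred; _+_; _∸_; _⊔_; _≤_; _<_; _≥_; z≤n; s≤s; s≤s⁻¹; _<ᵇ_; _≤ᵇ_; _≡ᵇ_; _≤?_; _<?_; _≟_)
open import Data.Nat.Properties
open import Data.Product using (Σ; _×_; _,_; proj₁; proj₂; ∃; ∃₂; uncurry)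
open import Data.Product.Function.NonDependent.Propositional using (_×-⇔_)
open import Data.Sum using (_⊎_; inj₁; inj₂)
open import Function using (_∘_; id; _∋_; _⇔_; mk⇔; Equivalence)
import Function.Properties.Equivalence as ⇔
open import Relation.Binary.Definitions using (DecidableEquality; tri<; tri≈; tri>)
open import Relation.Binary.PropositionalEquality
  using (_≡_; _≢_; refl; sym; trans; cong; cong₂; subst; subst₂; module ≡-Reasoning)
open import Relation.Nullary using (¬_; ¬?; yes; no; contradiction)
open import Relation.Nullary.Decidable using (T?)
open import Relation.Unary using (U)

¬T⇒not : ∀ {b} → ¬ T b → T (not b)
¬T⇒not {false} _  = _
¬T⇒not {true}  ¬t = ¬t _

not⇒¬T : ∀ {b} → T (not b) → ¬ T b
not⇒¬T {false} _ ()

¬T⇒false : ∀ {b} → ¬ T b → b ≡ false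
¬T⇒false {false} _  = refl
¬T⇒false {true}  ¬t = ⊥-elim (¬t _)

<ᵇ-true : ∀ {m n} → m < n → (m <ᵇ n) ≡ true
<ᵇ-true m<n = Equivalence.to T-≡ (<⇒<ᵇ m<n)

≤ᵇ-true : ∀ {m n} → m ≤ n → (m ≤ᵇ n) ≡ true
≤ᵇ-true m≤n = Equivalence.to T-≡ (≤⇒≤ᵇ m≤n)

<ᵇ-false : ∀ {m n} → n ≤ m → (m <ᵇ n) ≡ false
<ᵇ-false {m} {n} n≤m = ¬T⇒false (≤⇒≯ n≤m ∘ <ᵇ⇒< m n)

T-⇔⇒≡ : ∀ {a b} → (T a ⇔ T b) → a ≡ b
T-⇔⇒≡ {false} {false} _   = refl
T-⇔⇒≡ {false} {true}  a⇔b = ⊥-elim (Equivalence.from a⇔b _)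
T-⇔⇒≡ {true}  {false} a⇔b = ⊥-elim (Equivalence.to a⇔b _)
T-⇔⇒≡ {true}  {true}  _   = refl

T-all : ∀ {A : Set} (p : A → Bool) xs → T (all p xs) ⇔ All (T ∘ p) xs
T-all p []       = mk⇔ (λ _ → []) _
T-all p (x ∷ xs) = mk⇔
  (λ t → let (px , pxs) = Equivalence.to T-∧ t in px ∷ Equivalence.to (T-all p xs) pxs)
  (λ { (px ∷ pxs) → Equivalence.from T-∧ (px , Equivalence.from (T-all p xs) pxs) })

T-elem : ∀ x xs → T (elem x xs) ⇔ x ∈ xs
T-elem x [] = mk⇔ (λ ()) (λ ())
T-elem x (y ∷ ys) with x ≡ᵇ y in eq
... | true  = mk⇔ (λ _ → here (≡ᵇ⇒≡ x y (subst T (sym eq) _))) _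
... | false = mk⇔ (there ∘ Equivalence.to (T-elem x ys)) λ
  { (here refl) → ⊥-elim (subst T eq (≡⇒≡ᵇ x x refl))
  ; (there x∈ys) → Equivalence.from (T-elem x ys) x∈ys }

T-distinct : ∀ xs → T (distinct xs) ⇔ Unique xs
T-distinct []       = mk⇔ (λ _ → []) _
T-distinct (x ∷ xs) = mk⇔
  (λ t → let (x∉ , d) = Equivalence.to T-∧ t in
    ¬Any⇒All¬ xs (x∉xs x∉) ∷ Equivalence.to (T-distinct xs) d)
  (λ { (x≢ ∷ u) → Equivalence.from T-∧
    (x∉xs⁻¹ (All¬⇒¬Any x≢) , Equivalence.from (T-distinct xs) u) })
  where
  x∉xs : T (not (elem x xs)) → x ∉ xs
  x∉xs t = not⇒¬T t ∘ Equivalence.from (T-elem x xs)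
  x∉xs⁻¹ : x ∉ xs → T (not (elem x xs))
  x∉xs⁻¹ x∉ = ¬T⇒not (x∉ ∘ Equivalence.to (T-elem x xs))


-- Permutations and counting

InRange : ℕ → ℕ → Set
InRange n v = 1 ≤ v × v ≤ n

∈-range1 : ∀ {n v} → v ∈ range1 n ⇔ InRange n v
∈-range1 {n} = mk⇔ to (λ { (s≤s z≤n , v≤n) → ∈-applyUpTo⁺ suc v≤n })
  where
  to : ∀ {v} → v ∈ range1 n → InRange n v
  to v∈ with ∈-applyUpTo⁻ suc v∈
  ... | _ , i<n , refl = s≤s z≤n , i<n

range1-unique : ∀ n → Unique (range1 n)
range1-unique n = Unique.applyUpTo⁺₁ suc n (λ i<j _ → <⇒≢ (s≤s i<j))

∈-words : ∀ {xs} k {w} → w ∈ words xs k ⇔ (length w ≡ k × All (_∈ xs) w)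
∈-words zero {[]}    = mk⇔ (λ _ → refl , []) (λ _ → here refl)
∈-words zero {_ ∷ _} = mk⇔ (λ { (here ()) ; (there ()) }) (λ { (() , _) })
∈-words {xs} (suc k) = mk⇔ to from
  where
  to : ∀ {w} → w ∈ words xs (suc k) → length w ≡ suc k × All (_∈ xs) w
  to w∈ with find (∈-concatMap⁻ _ {xs = xs} w∈)
  ... | x , x∈ , w∈′ with ∈-map⁻ (x ∷_) w∈′
  ... | w′ , w′∈ , refl = let (len , w′⊆xs) = Equivalence.to (∈-words k) w′∈ in cong suc len , x∈ ∷ w′⊆xs
  from : ∀ {w} → length w ≡ suc k × All (_∈ xs) w → w ∈ words xs (suc k)
  from {x ∷ w} (len , x∈ ∷ w⊆xs) =
    ∈-concatMap⁺ _ {xs = xs} (lose x∈ (∈-map⁺ (x ∷_) (Equivalence.from (∈-words k) (suc-injective len , w⊆xs))))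

words-unique : ∀ {xs} k → Unique xs → Unique (words xs k)
words-unique zero    _ = [] ∷ []
words-unique {xs} (suc k) xs! =
  Unique.concat⁺ (All.map⁺ (All.tabulate λ _ → Unique.map⁺ (∷-injectiveʳ) (words-unique k xs!)))
                 (AllPairs.map⁺ (AllPairs.map disjoint xs!))
  where
  disjoint : ∀ {x y} → x ≢ y → Disjoint (map (x ∷_) (words xs k)) (map (y ∷_) (words xs k))
  disjoint x≢y (v∈x , v∈y) with ∈-map⁻ _ v∈x | ∈-map⁻ _ v∈y
  ... | _ , _ , refl | _ , _ , eq = x≢y (proj₁ (∷-injective eq))

record IsPerm (n : ℕ) (π : List ℕ) : Set where
  constructor isPerm
  field
    unique  : Unique π
    length≡ : length π ≡ n
    inRange : All (InRange n) π

∈S⇔IsPerm : ∀ {n π} → π ∈ S n ⇔ IsPerm n π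
∈S⇔IsPerm {n} = mk⇔
  (λ π∈ → let (π∈words , d) = ∈-filter⁻ (T? ∘ distinct) π∈
              (len , π⊆range) = Equivalence.to (∈-words n) π∈words
          in isPerm (Equivalence.to (T-distinct _) d) len (All.map (Equivalence.to ∈-range1) π⊆range))
  (λ { (isPerm π! len inR) → ∈-filter⁺ (T? ∘ distinct)
         (Equivalence.from (∈-words n) (len , All.map (Equivalence.from ∈-range1) inR))
         (Equivalence.from (T-distinct _) π!) })

S-unique : ∀ n → Unique (S n)
S-unique n = Unique.filter⁺ (T? ∘ distinct) (words-unique n (range1-unique n))

unique-++ʳ : ∀ {A : Set} (u : List A) {v} → Unique (u ++ v) → Unique v
unique-++ʳ []      v! = v!
unique-++ʳ (_ ∷ u) (_ ∷ uv!) = unique-++ʳ u uv!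

unique-++-disjoint : ∀ {A : Set} {u v : List A} {w} → Unique (u ++ v) → w ∈ u → w ∉ v
unique-++-disjoint {u = _ ∷ u} (w≢ ∷ _)   (here refl) w∈v = All.lookup w≢ (∈-++⁺ʳ u w∈v) refl
unique-++-disjoint            (_ ∷ uv!) (there w∈u) = unique-++-disjoint uv! w∈u

module _ {A : Set} where

  unique∧set⇒length≡ : ∀ {xs ys : List A} → Unique xs → Unique ys → (∀ {z} → z ∈ xs ⇔ z ∈ ys) →
                       length xs ≡ length ys
  unique∧set⇒length≡ xs! ys! xs∼ys = ↭-length (∼bag⇒↭ (unique∧set⇒bag xs! ys! xs∼ys))

  unique-map-injectiveOn : ∀ {f : A → A} {xs} →
    (∀ {x y} → x ∈ xs → y ∈ xs → f x ≡ f y → x ≡ y) → Unique xs → Unique (map f xs)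
  unique-map-injectiveOn {xs = []}     inj []          = []
  unique-map-injectiveOn {xs = x ∷ xs} inj (x≢ ∷ xs!) =
    All.map⁺ (All.tabulate (λ y∈ fx≡fy → All.lookup x≢ y∈ (inj (here refl) (there y∈) fx≡fy)))
    ∷ unique-map-injectiveOn (λ x∈ y∈ → inj (there x∈) (there y∈)) xs!

  length-filterᵇ-involution : ∀ (p q : A → Bool) (f : A → A) {xs} → Unique xs →
    (∀ {x} → x ∈ xs → f x ∈ xs) → (∀ {x} → x ∈ xs → f (f x) ≡ x) →
    (∀ {x} → x ∈ xs → p x ≡ q (f x)) →
    length (filterᵇ p xs) ≡ length (filterᵇ q xs)
  length-filterᵇ-involution p q f {xs} xs! f∈ ff p≡qf = begin
    length (filterᵇ p xs)          ≡⟨ unique∧set⇒length≡ P! fQ! (mk⇔ to from) ⟩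
    length (map f (filterᵇ q xs))  ≡⟨ length-map f (filterᵇ q xs) ⟩
    length (filterᵇ q xs)          ∎
    where
    open ≡-Reasoning
    P! = Unique.filter⁺ (T? ∘ p) xs!
    fQ! = unique-map-injectiveOn
      (λ x∈ y∈ e → let x∈xs = proj₁ (∈-filter⁻ (T? ∘ q) x∈); y∈xs = proj₁ (∈-filter⁻ (T? ∘ q) y∈)
                   in trans (sym (ff x∈xs)) (trans (cong f e) (ff y∈xs)))
      (Unique.filter⁺ (T? ∘ q) xs!)
    to : ∀ {z} → z ∈ filterᵇ p xs → z ∈ map f (filterᵇ q xs)
    to z∈ = let (z∈xs , pz) = ∈-filter⁻ (T? ∘ p) z∈ in
      subst (_∈ map f (filterᵇ q xs)) (ff z∈xs)
        (∈-map⁺ f (∈-filter⁺ (T? ∘ q) (f∈ z∈xs) (subst T (p≡qf z∈xs) pz)))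
    from : ∀ {z} → z ∈ map f (filterᵇ q xs) → z ∈ filterᵇ p xs
    from z∈ with ∈-map⁻ f z∈
    ... | w , w∈ , refl = let (w∈xs , qw) = ∈-filter⁻ (T? ∘ q) w∈ in
      ∈-filter⁺ (T? ∘ p) (f∈ w∈xs) (subst T (sym (trans (p≡qf (f∈ w∈xs)) (cong q (ff w∈xs)))) qw)

countAvoiders-involution : ∀ {n} p q (F : List ℕ → List ℕ) →
  (∀ {π} → IsPerm n π → IsPerm n (F π)) → (∀ {π} → IsPerm n π → F (F π) ≡ π) →
  (∀ {π} → IsPerm n π → contains p π ≡ contains q (F π)) → countAvoiders p n ≡ countAvoiders q n
countAvoiders-involution {n} p q F F-perm F-inv p≡q∘F =
  length-filterᵇ-involution (avoids p) (avoids q) F (S-unique n)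
    (Equivalence.from ∈S⇔IsPerm ∘ F-perm ∘ Equivalence.to ∈S⇔IsPerm)
    (F-inv ∘ Equivalence.to ∈S⇔IsPerm)
    (cong not ∘ p≡q∘F ∘ Equivalence.to ∈S⇔IsPerm)

module _ {A : Set} (_≟ᴬ_ : DecidableEquality A) where

  unique∧⊆⇒length≤ : ∀ {xs ys : List A} → Unique xs → Unique ys → xs ⊆ ys → length xs ≤ length ys
  unique∧⊆⇒length≤ {xs} {ys} xs! ys! xs⊆ys = begin
    length xs               ≡⟨ unique∧set⇒length≡ xs! (Unique.filter⁺ in? ys!) (mk⇔ to from) ⟩
    length (filter in? ys)  ≤⟨ length-filter in? ys ⟩
    length ys               ∎
    where
    open ≤-Reasoning
    in? = λ y → ∈? _≟ᴬ_ y xs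
    to : ∀ {z} → z ∈ xs → z ∈ filter in? ys
    to z∈ = ∈-filter⁺ in? (xs⊆ys z∈) z∈
    from : ∀ {z} → z ∈ filter in? ys → z ∈ xs
    from = proj₂ ∘ ∈-filter⁻ in? {xs = ys}

pigeonhole : ∀ {n π v} → IsPerm n π → InRange n v → v ∈ π
pigeonhole {n} {π} {v} (isPerm π! len inR) v∈range with ∈? _≟_ v π
... | yes v∈π = v∈π
... | no  v∉π = ⊥-elim (<-irrefl refl (begin-strict
    n                      ≡⟨ sym len ⟩
    length π               ≤⟨ unique∧⊆⇒length≤ _≟_ π! (Unique.filter⁺ ≢v? (range1-unique n)) π⊆ ⟩
    length (filter ≢v? R)  <⟨ filter-notAll ≢v? R (lose (Equivalence.from ∈-range1 v∈range) (λ v≢v → v≢v refl)) ⟩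
    length R               ≡⟨ length-applyUpTo suc n ⟩
    n                      ∎))
  where
  open ≤-Reasoning
  R = range1 n
  ≢v? = λ x → ¬? (x ≟ v)
  π⊆ : π ⊆ filter ≢v? R
  π⊆ z∈ = ∈-filter⁺ ≢v? (Equivalence.from ∈-range1 (All.lookup inR z∈)) (λ z≡v → v∉π (subst (_∈ π) z≡v z∈))


-- Lehmer codes

countBelow : ℕ → List ℕ → ℕ
countBelow x L = length (filter (_<? x) L)

countBelow-∷-< : ∀ {x y} L → y < x → countBelow x (y ∷ L) ≡ suc (countBelow x L)
countBelow-∷-< L y<x = cong length (filter-accept (_<? _) y<x)

countBelow-∷-≥ : ∀ {x y} L → x ≤ y → countBelow x (y ∷ L) ≡ countBelow x L
countBelow-∷-≥ L x≤y = cong length (filter-reject (_<? _) (≤⇒≯ x≤y))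

countBelow-++ : ∀ t A B → countBelow t (A ++ B) ≡ countBelow t A + countBelow t B
countBelow-++ t A B = trans (cong length (filter-++ (_<? t) A B)) (length-++ (filter (_<? t) A))

countBelow-none : ∀ {t} L → All (t ≤_) L → countBelow t L ≡ 0
countBelow-none _ t≤L = cong length (filter-none (_<? _) (All.map ≤⇒≯ t≤L))

countBelow-none⁻ : ∀ {t} L → countBelow t L ≡ 0 → All (t ≤_) L
countBelow-none⁻ []      _ = []
countBelow-none⁻ {t} (x ∷ L) c≡0 with x <? t
... | yes x<t = contradiction (trans (sym (countBelow-∷-< L x<t)) c≡0) (λ ())
... | no  x≮t = ≮⇒≥ x≮t ∷ countBelow-none⁻ L (trans (sym (countBelow-∷-≥ L (≮⇒≥ x≮t))) c≡0)

countBelow-all : ∀ {t} L → All (_< t) L → countBelow t L ≡ length L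
countBelow-all _ L<t = cong length (filter-all (_<? _) L<t)

countBelow-mono : ∀ {a b} L → a ≤ b → countBelow a L ≤ countBelow b L
countBelow-mono []      _   = z≤n
countBelow-mono {a} {b} (x ∷ L) a≤b with x <? a | x <? b
... | yes x<a | yes x<b rewrite countBelow-∷-< L x<a | countBelow-∷-< L x<b = s≤s (countBelow-mono L a≤b)
... | yes x<a | no  x≮b = contradiction (<-≤-trans x<a a≤b) x≮b
... | no  x≮a | yes x<b rewrite countBelow-∷-≥ L (≮⇒≥ x≮a) | countBelow-∷-< L x<b = m≤n⇒m≤1+n (countBelow-mono L a≤b)
... | no  x≮a | no  x≮b rewrite countBelow-∷-≥ L (≮⇒≥ x≮a) | countBelow-∷-≥ L (≮⇒≥ x≮b) = countBelow-mono L a≤b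

countBelow-suc : ∀ {t L} → Unique L → countBelow (suc t) L ≤ suc (countBelow t L)
countBelow-suc {t} {[]} _ = z≤n
countBelow-suc {t} {x ∷ L} (x≢ ∷ L!) with x <? t | x <? suc t
... | yes x<t | yes x<1+t rewrite countBelow-∷-< L x<t | countBelow-∷-< L x<1+t = s≤s (countBelow-suc L!)
... | yes x<t | no  x≮1+t = contradiction (m<n⇒m<1+n x<t) x≮1+t
... | no  x≮t | no  x≮1+t rewrite countBelow-∷-≥ L (≮⇒≥ x≮t) | countBelow-∷-≥ L (≮⇒≥ x≮1+t) = countBelow-suc L!
... | no  x≮t | yes x<1+t rewrite countBelow-∷-≥ L (≮⇒≥ x≮t) | countBelow-∷-< L x<1+t =
  s≤s (≤-reflexive (countBelow-skip L (All.map (λ x≢y y≡t → x≢y (trans x≡t (sym y≡t))) x≢)))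
  where
  x≡t : x ≡ t
  x≡t = ≤-antisym (s≤s⁻¹ x<1+t) (≮⇒≥ x≮t)
  countBelow-skip : ∀ M → All (_≢ t) M → countBelow (suc t) M ≡ countBelow t M
  countBelow-skip []      _ = refl
  countBelow-skip (y ∷ M) (y≢t ∷ M≢t) with <-cmp y t
  ... | tri< y<t _ _ = trans (countBelow-∷-< M (m<n⇒m<1+n y<t))
                             (trans (cong suc (countBelow-skip M M≢t)) (sym (countBelow-∷-< M y<t)))
  ... | tri≈ _ y≡t _ = contradiction y≡t y≢t
  ... | tri> _ _ t<y = trans (countBelow-∷-≥ M t<y)
                             (trans (countBelow-skip M M≢t) (sym (countBelow-∷-≥ M (<⇒≤ t<y))))

countBelow-++-none : ∀ {t F} R → All (t ≤_) F → countBelow t (F ++ R) ≡ countBelow t R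
countBelow-++-none {t} {F} R t≤F = trans (countBelow-++ t F R) (cong (_+ countBelow t R) (countBelow-none F t≤F))

countBelow-∷-cong : ∀ {t} x {R R′} → countBelow t R ≡ countBelow t R′ → countBelow t (x ∷ R) ≡ countBelow t (x ∷ R′)
countBelow-∷-cong {t} x {R} {R′} eq with x <? t
... | yes x<t = trans (countBelow-∷-< R x<t) (trans (cong suc eq) (sym (countBelow-∷-< R′ x<t)))
... | no  x≮t = trans (countBelow-∷-≥ R (≮⇒≥ x≮t)) (trans eq (sym (countBelow-∷-≥ R′ (≮⇒≥ x≮t))))

countBelow-perm : ∀ {n π d} → IsPerm n π → d ≤ n → countBelow (suc d) π ≡ d
countBelow-perm {n} {π} {d} P@(isPerm π! _ inR) d≤n = begin
  countBelow (suc d) π  ≡⟨ unique∧set⇒length≡ (Unique.filter⁺ (_<? suc d) π!) (range1-unique d) (mk⇔ to from) ⟩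
  length (range1 d)     ≡⟨ length-applyUpTo suc d ⟩
  d                     ∎
  where
  open ≡-Reasoning
  to : ∀ {v} → v ∈ filter (_<? suc d) π → v ∈ range1 d
  to v∈ = let (v∈π , v≤d) = ∈-filter⁻ (_<? suc d) v∈ in
    Equivalence.from ∈-range1 (proj₁ (All.lookup inR v∈π) , ≤-pred v≤d)
  from : ∀ {v} → v ∈ range1 d → v ∈ filter (_<? suc d) π
  from v∈ = let (1≤v , v≤d) = Equivalence.to ∈-range1 v∈ in
    ∈-filter⁺ (_<? suc d) (pigeonhole P (1≤v , ≤-trans v≤d d≤n)) (s≤s v≤d)

countBelow-map : ∀ {f x y} M → (∀ {a} → a ∈ M → (f a < y ⇔ a < x)) →
                 countBelow y (map f M) ≡ countBelow x M
countBelow-map []      _ = refl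
countBelow-map {f} {x} (a ∷ M) mono with a <? x
... | yes a<x = trans (countBelow-∷-< (map f M) (Equivalence.from (mono (here refl)) a<x))
                      (trans (cong suc (countBelow-map M (mono ∘ there))) (sym (countBelow-∷-< M a<x)))
... | no  a≮x = trans (countBelow-∷-≥ (map f M) (≮⇒≥ (a≮x ∘ Equivalence.to (mono (here refl)))))
                      (trans (countBelow-map M (mono ∘ there)) (sym (countBelow-∷-≥ M (≮⇒≥ a≮x))))

lehmer : List ℕ → List ℕ
lehmer []       = []
lehmer (x ∷ xs) = countBelow x xs ∷ lehmer xs

data IsLehmer : List ℕ → Set where
  []  : IsLehmer []
  _∷_ : ∀ {d ds} → d ≤ length ds → IsLehmer ds → IsLehmer (d ∷ ds)

length-lehmer : ∀ xs → length (lehmer xs) ≡ length xs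
length-lehmer []       = refl
length-lehmer (x ∷ xs) = cong suc (length-lehmer xs)

lehmer-isLehmer : ∀ xs → IsLehmer (lehmer xs)
lehmer-isLehmer []       = []
lehmer-isLehmer (x ∷ xs) =
  subst (countBelow x xs ≤_) (sym (length-lehmer xs)) (length-filter (_<? x) xs) ∷ lehmer-isLehmer xs

OrderPreservingOn : List ℕ → (ℕ → ℕ) → Set
OrderPreservingOn L f = ∀ {a b} → a ∈ L → b ∈ L → (f a < f b ⇔ a < b)

lehmer-map : ∀ {f} L → OrderPreservingOn L f → lehmer (map f L) ≡ lehmer L
lehmer-map []      _    = refl
lehmer-map (x ∷ L) mono =
  cong₂ _∷_ (countBelow-map L (λ a∈ → mono (there a∈) (here refl)))
            (lehmer-map L (λ a∈ b∈ → mono (there a∈) (there b∈)))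

orderPreserving⇒injective : ∀ {L f} → OrderPreservingOn L f →
                            ∀ {a b} → a ∈ L → b ∈ L → f a ≡ f b → a ≡ b
orderPreserving⇒injective mono {a} {b} a∈ b∈ fa≡fb with <-cmp a b
... | tri< a<b _ _ = contradiction fa≡fb (<⇒≢ (Equivalence.from (mono a∈ b∈) a<b))
... | tri≈ _ a≡b _ = a≡b
... | tri> _ _ b<a = contradiction (sym fa≡fb) (<⇒≢ (Equivalence.from (mono b∈ a∈) b<a))

shiftFrom : ℕ → ℕ → ℕ
shiftFrom a v = if v <ᵇ a then v else suc v

unshiftFrom : ℕ → ℕ → ℕ
unshiftFrom a v = if v <ᵇ a then v else pred v

shiftFrom-< : ∀ {a v} → v < a → shiftFrom a v ≡ v
shiftFrom-< v<a rewrite <ᵇ-true v<a = refl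

shiftFrom-≥ : ∀ {a v} → a ≤ v → shiftFrom a v ≡ suc v
shiftFrom-≥ a≤v rewrite <ᵇ-false a≤v = refl

unshiftFrom-< : ∀ {a v} → v < a → unshiftFrom a v ≡ v
unshiftFrom-< v<a rewrite <ᵇ-true v<a = refl

unshiftFrom-> : ∀ {a v} → a < v → unshiftFrom a v ≡ pred v
unshiftFrom-> a<v rewrite <ᵇ-false (<⇒≤ a<v) = refl

shiftFrom-mono : ∀ a {x y} → (shiftFrom a x < shiftFrom a y ⇔ x < y)
shiftFrom-mono a {x} {y} with x <? a | y <? a
... | yes x<a | yes y<a rewrite shiftFrom-< x<a | shiftFrom-< y<a = mk⇔ id id
... | yes x<a | no  y≮a rewrite shiftFrom-< x<a | shiftFrom-≥ (≮⇒≥ y≮a) =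
  mk⇔ (λ _ → <-≤-trans x<a (≮⇒≥ y≮a)) m<n⇒m<1+n
... | no  x≮a | yes y<a rewrite shiftFrom-≥ (≮⇒≥ x≮a) | shiftFrom-< y<a =
  mk⇔ (λ sx<y → ⊥-elim (x≮y (<-trans (n<1+n x) sx<y))) (⊥-elim ∘ x≮y)
  where
  x≮y : ¬ x < y
  x≮y x<y = <-asym x<y (<-≤-trans y<a (≮⇒≥ x≮a))
... | no  x≮a | no  y≮a rewrite shiftFrom-≥ (≮⇒≥ x≮a) | shiftFrom-≥ (≮⇒≥ y≮a) = mk⇔ s≤s⁻¹ s≤s

shiftFrom-<-self : ∀ a {v} → (shiftFrom a v < a ⇔ v < a)
shiftFrom-<-self a {v} with v <? a
... | yes v<a rewrite shiftFrom-< v<a = mk⇔ id id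
... | no  v≮a rewrite shiftFrom-≥ (≮⇒≥ v≮a) =
  mk⇔ (λ sv<a → contradiction (<-trans (n<1+n v) sv<a) v≮a) (λ v<a → contradiction v<a v≮a)

shiftFrom-≢ : ∀ a v → shiftFrom a v ≢ a
shiftFrom-≢ a v with v <? a
... | yes v<a rewrite shiftFrom-< v<a = <⇒≢ v<a
... | no  v≮a rewrite shiftFrom-≥ (≮⇒≥ v≮a) = >⇒≢ (s≤s (≮⇒≥ v≮a))

shiftFrom-inRange : ∀ {a m v} → InRange m v → InRange (suc m) (shiftFrom a v)
shiftFrom-inRange {a} {v = v} (1≤v , v≤m) with v <? a
... | yes v<a rewrite shiftFrom-< v<a = 1≤v , m≤n⇒m≤1+n v≤m
... | no  v≮a rewrite shiftFrom-≥ (≮⇒≥ v≮a) = s≤s z≤n , s≤s v≤m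

unlehmer : List ℕ → List ℕ
unlehmer []       = []
unlehmer (d ∷ ds) = suc d ∷ map (shiftFrom (suc d)) (unlehmer ds)

unlehmer-isPerm : ∀ {c} → IsLehmer c → IsPerm (length c) (unlehmer c)
unlehmer-isPerm [] = isPerm [] refl []
unlehmer-isPerm {d ∷ ds} (d≤ ∷ c) with unlehmer-isPerm c
... | isPerm U! len inR =
  isPerm (All.map⁺ (All.tabulate (λ {v} _ → shiftFrom-≢ (suc d) v ∘ sym))
           ∷ unique-map-injectiveOn (orderPreserving⇒injective (λ _ _ → shiftFrom-mono (suc d))) U!)
         (cong suc (trans (length-map _ (unlehmer ds)) len))
         ((s≤s z≤n , s≤s d≤) ∷ All.map⁺ (All.map (shiftFrom-inRange {suc d}) inR))

lehmer-unlehmer : ∀ {c} → IsLehmer c → lehmer (unlehmer c) ≡ c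
lehmer-unlehmer [] = refl
lehmer-unlehmer {d ∷ ds} (d≤ ∷ c) = cong₂ _∷_
  (trans (countBelow-map (unlehmer ds) (λ _ → shiftFrom-<-self (suc d))) (countBelow-perm (unlehmer-isPerm c) d≤))
  (trans (lehmer-map (unlehmer ds) (λ _ _ → shiftFrom-mono (suc d))) (lehmer-unlehmer c))

shiftFrom∘unshiftFrom : ∀ {a v} → v ≢ a → shiftFrom a (unshiftFrom a v) ≡ v
shiftFrom∘unshiftFrom {a} {v} v≢a with <-cmp v a
... | tri< v<a _ _ rewrite unshiftFrom-< v<a = shiftFrom-< v<a
... | tri≈ _ v≡a _ = contradiction v≡a v≢a
shiftFrom∘unshiftFrom {a} {suc w} _ | tri> _ _ a<v rewrite unshiftFrom-> a<v = shiftFrom-≥ (s≤s⁻¹ a<v)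

unshiftFrom-mono : ∀ {a x y} → x ≢ a → y ≢ a → (unshiftFrom a x < unshiftFrom a y ⇔ x < y)
unshiftFrom-mono {a} {x} {y} x≢a y≢a =
  subst₂ (λ x′ y′ → unshiftFrom a x < unshiftFrom a y ⇔ x′ < y′)
         (shiftFrom∘unshiftFrom x≢a) (shiftFrom∘unshiftFrom y≢a)
         (⇔.sym (shiftFrom-mono a))

unshiftFrom-inRange : ∀ {a m v} → 1 ≤ a → a ≤ suc m → v ≢ a → InRange (suc m) v → InRange m (unshiftFrom a v)
unshiftFrom-inRange {a} {m} {v} 1≤a a≤1+m v≢a (1≤v , v≤1+m) with <-cmp v a
... | tri< v<a _ _ rewrite unshiftFrom-< v<a = 1≤v , s≤s⁻¹ (<-≤-trans v<a a≤1+m)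
... | tri≈ _ v≡a _ = contradiction v≡a v≢a
unshiftFrom-inRange {v = suc w} 1≤a _ _ (_ , w<1+m) | tri> _ _ a<v rewrite unshiftFrom-> a<v =
  ≤-trans 1≤a (s≤s⁻¹ a<v) , s≤s⁻¹ w<1+m

-- Closing the gap left by the head value turns the tail into a permutation of 1 … m with the same code.
unlehmer-lehmer : ∀ n {π} → IsPerm n π → unlehmer (lehmer π) ≡ π
unlehmer-lehmer _ {[]} _ = refl
unlehmer-lehmer _ {zero ∷ _} (isPerm _ _ ((() , _) ∷ _))
unlehmer-lehmer zero {_ ∷ _} (isPerm _ () _)
unlehmer-lehmer (suc m) {suc d ∷ xs} P@(isPerm (x≢ ∷ xs!) len (x∈ ∷ inR)) = begin
  suc (countBelow (suc d) xs) ∷ map (shiftFrom (suc (countBelow (suc d) xs))) (unlehmer (lehmer xs))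
    ≡⟨ cong (λ c → suc c ∷ map (shiftFrom (suc c)) (unlehmer (lehmer xs))) countBelow≡ ⟩
  suc d ∷ map (shiftFrom (suc d)) (unlehmer (lehmer xs))
    ≡⟨ cong (λ c → suc d ∷ map (shiftFrom (suc d)) (unlehmer c)) (sym (lehmer-map xs unshift-mono)) ⟩
  suc d ∷ map (shiftFrom (suc d)) (unlehmer (lehmer (map (unshiftFrom (suc d)) xs)))
    ≡⟨ cong (λ ys → suc d ∷ map (shiftFrom (suc d)) ys) (unlehmer-lehmer m P′) ⟩
  suc d ∷ map (shiftFrom (suc d)) (map (unshiftFrom (suc d)) xs)
    ≡⟨ cong (suc d ∷_) (trans (sym (map-∘ xs)) (map-id-local (All.map shiftFrom∘unshiftFrom ≢x))) ⟩
  suc d ∷ xs ∎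
  where
  open ≡-Reasoning
  ≢x : All (_≢ suc d) xs
  ≢x = All.map (_∘ sym) x≢
  countBelow≡ : countBelow (suc d) xs ≡ d
  countBelow≡ = trans (sym (countBelow-∷-≥ xs ≤-refl)) (countBelow-perm P (m≤n⇒m≤1+n (s≤s⁻¹ (proj₂ x∈))))
  unshift-mono : OrderPreservingOn xs (unshiftFrom (suc d))
  unshift-mono a∈ b∈ = unshiftFrom-mono (All.lookup ≢x a∈) (All.lookup ≢x b∈)
  P′ : IsPerm m (map (unshiftFrom (suc d)) xs)
  P′ = isPerm (unique-map-injectiveOn (orderPreserving⇒injective unshift-mono) xs!)
              (trans (length-map _ xs) (suc-injective len))
              (All.map⁺ (All.zipWith (λ (v≢ , v∈) → unshiftFrom-inRange {suc d} (s≤s z≤n) (proj₂ x∈) v≢ v∈) (≢x , inR)))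


-- An involution on Lehmer codes

-- On the Lehmer code of a list, the first entry below 2 belongs to one of the two smallest
-- elements, and it is 1 exactly when these two occur in decreasing order.
bottomDescent : List ℕ → Bool
bottomDescent []                 = false
bottomDescent (zero ∷ _)         = false
bottomDescent (suc zero ∷ _)     = true
bottomDescent (suc (suc _) ∷ ds) = bottomDescent ds

rotate : Bool → ℕ → ℕ
rotate true  0 = 1
rotate true  1 = 2
rotate true  2 = 0
rotate false 0 = 2
rotate false 1 = 0
rotate false 2 = 1
rotate _     d = d

swap01 : ℕ → ℕ
swap01 0 = 1
swap01 1 = 0
swap01 d = d

-- With a single later entry there is no pair below to consult, and swapping 0 and 1 is what
-- reverses the order of the last two entries.
toggle : List ℕ → List ℕ
toggle (d ∷ ds@(_ ∷ _ ∷ _)) = rotate (bottomDescent ds) d ∷ toggle ds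
toggle (d ∷ e ∷ [])         = swap01 d ∷ e ∷ []
toggle ds                   = ds

toggle-∷ : ∀ {d ds} → 2 ≤ length ds → toggle (d ∷ ds) ≡ rotate (bottomDescent ds) d ∷ toggle ds
toggle-∷ {ds = _ ∷ []}    (s≤s ())
toggle-∷ {ds = _ ∷ _ ∷ _} _ = refl

rotate-not : ∀ b d → rotate (not b) (rotate b d) ≡ d
rotate-not true  0 = refl
rotate-not true  1 = refl
rotate-not true  2 = refl
rotate-not true  (suc (suc (suc _))) = refl
rotate-not false 0 = refl
rotate-not false 1 = refl
rotate-not false 2 = refl
rotate-not false (suc (suc (suc _))) = refl

rotate-≤ : ∀ b {d m} → 2 ≤ m → d ≤ m → rotate b d ≤ m
rotate-≤ true  {0} 2≤m _ = ≤-trans (s≤s z≤n) 2≤m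
rotate-≤ true  {1} 2≤m _ = 2≤m
rotate-≤ true  {2} _   _ = z≤n
rotate-≤ true  {suc (suc (suc _))} _ d≤m = d≤m
rotate-≤ false {0} 2≤m _ = 2≤m
rotate-≤ false {1} _   _ = z≤n
rotate-≤ false {2} 2≤m _ = ≤-trans (s≤s z≤n) 2≤m
rotate-≤ false {suc (suc (suc _))} _ d≤m = d≤m

length-toggle : ∀ c → length (toggle c) ≡ length c
length-toggle []              = refl
length-toggle (_ ∷ [])        = refl
length-toggle (_ ∷ _ ∷ [])    = refl
length-toggle (_ ∷ ds@(_ ∷ _ ∷ _)) = cong suc (length-toggle ds)

bottomDescent-rotate : ∀ b d {r s} → bottomDescent s ≡ b → bottomDescent r ≡ not b →
                       bottomDescent (rotate b d ∷ r) ≡ not (bottomDescent (d ∷ s))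
bottomDescent-rotate true  0 _ _  = refl
bottomDescent-rotate true  1 _ r≡ = r≡
bottomDescent-rotate true  2 s≡ _ rewrite s≡ = refl
bottomDescent-rotate true  (suc (suc (suc _))) s≡ r≡ rewrite s≡ = r≡
bottomDescent-rotate false 0 _ r≡ = r≡
bottomDescent-rotate false 1 _ _  = refl
bottomDescent-rotate false 2 s≡ _ rewrite s≡ = refl
bottomDescent-rotate false (suc (suc (suc _))) s≡ r≡ rewrite s≡ = r≡

bottomDescent-toggle : ∀ {c} → IsLehmer c → 2 ≤ length c → bottomDescent (toggle c) ≡ not (bottomDescent c)
bottomDescent-toggle {_ ∷ []}               _ (s≤s ())
bottomDescent-toggle {0 ∷ _ ∷ []}           _ _ = refl
bottomDescent-toggle {1 ∷ _ ∷ []}           _ _ = refl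
bottomDescent-toggle {suc (suc _) ∷ _ ∷ []} (s≤s () ∷ _) _
bottomDescent-toggle {d ∷ ds@(_ ∷ _ ∷ _)}   (_ ∷ c) _ =
  bottomDescent-rotate (bottomDescent ds) d refl (bottomDescent-toggle c (s≤s (s≤s z≤n)))

toggle-isLehmer : ∀ {c} → IsLehmer c → IsLehmer (toggle c)
toggle-isLehmer []                              = []
toggle-isLehmer (d≤ ∷ [])                       = d≤ ∷ []
toggle-isLehmer {0 ∷ _ ∷ []}           (_ ∷ c) = s≤s z≤n ∷ c
toggle-isLehmer {1 ∷ _ ∷ []}           (_ ∷ c) = z≤n ∷ c
toggle-isLehmer {suc (suc _) ∷ _ ∷ []} (s≤s () ∷ _)
toggle-isLehmer {d ∷ ds@(_ ∷ _ ∷ _)}   (d≤ ∷ c) =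
  subst (rotate (bottomDescent ds) d ≤_) (sym (length-toggle ds)) (rotate-≤ _ (s≤s (s≤s z≤n)) d≤)
  ∷ toggle-isLehmer c

toggle-involutive : ∀ {c} → IsLehmer c → toggle (toggle c) ≡ c
toggle-involutive []                              = refl
toggle-involutive (_ ∷ [])                        = refl
toggle-involutive {0 ∷ _ ∷ []}           _        = refl
toggle-involutive {1 ∷ _ ∷ []}           _        = refl
toggle-involutive {suc (suc _) ∷ _ ∷ []} (s≤s () ∷ _)
toggle-involutive {d ∷ ds@(_ ∷ _ ∷ _)}   (_ ∷ c) = begin
  toggle (rotate (bottomDescent ds) d ∷ toggle ds)
    ≡⟨ toggle-∷ (subst (2 ≤_) (sym (length-toggle ds)) (s≤s (s≤s z≤n))) ⟩
  rotate (bottomDescent (toggle ds)) (rotate (bottomDescent ds) d) ∷ toggle (toggle ds)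
    ≡⟨ cong₂ _∷_ (trans (cong (λ b → rotate b (rotate (bottomDescent ds) d)) (bottomDescent-toggle c (s≤s (s≤s z≤n))))
                        (rotate-not (bottomDescent ds) d))
                 (toggle-involutive c) ⟩
  d ∷ ds ∎
  where open ≡-Reasoning

-- The state of a scan is the number of remaining entries below the largest entry already read
-- (step-countBelow). The tests only ask whether it is at most 2, so states are compared up to _≈₂_.
step : ℕ → ℕ → ℕ
step k d = if d <ᵇ k then pred k else d

scan : (ℕ → ℕ → List ℕ → Bool) → ℕ → List ℕ → Bool
scan test k []       = false
scan test k (d ∷ ds) = test k d ds ∨ scan test (step k d) ds

test₁₂₃ : ℕ → ℕ → List ℕ → Bool
test₁₂₃ k d ds = (2 ≤ᵇ length ds) ∧ (k ≤ᵇ 2) ∧ (d ≡ᵇ 2) ∧ bottomDescent ds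

test₃₂₁ : ℕ → ℕ → List ℕ → Bool
test₃₂₁ k d ds = (2 ≤ᵇ length ds) ∧ (k ≤ᵇ 2) ∧ (d ≡ᵇ 0) ∧ not (bottomDescent ds)

_≈₂_ : ℕ → ℕ → Set
k ≈₂ k′ = k ≡ k′ ⊎ (k ≤ 2 × k′ ≤ 2)

rotate-≈₂ : ∀ b d → d ≈₂ rotate b d
rotate-≈₂ true  0 = inj₂ (z≤n , s≤s z≤n)
rotate-≈₂ true  1 = inj₂ (s≤s z≤n , s≤s (s≤s z≤n))
rotate-≈₂ true  2 = inj₂ (s≤s (s≤s z≤n) , z≤n)
rotate-≈₂ true  (suc (suc (suc _))) = inj₁ refl
rotate-≈₂ false 0 = inj₂ (z≤n , s≤s (s≤s z≤n))
rotate-≈₂ false 1 = inj₂ (s≤s z≤n , z≤n)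
rotate-≈₂ false 2 = inj₂ (s≤s (s≤s z≤n) , s≤s z≤n)
rotate-≈₂ false (suc (suc (suc _))) = inj₁ refl

step-≤2 : ∀ {k d} → k ≤ 2 → d ≤ 2 → step k d ≤ 2
step-≤2 {k} {d} k≤2 d≤2 with d <ᵇ k
... | true  = ≤-trans pred[n]≤n k≤2
... | false = d≤2

step-3≤k : ∀ {k d} → 3 ≤ k → d ≤ 2 → step k d ≡ pred k
step-3≤k 3≤k d≤2 rewrite <ᵇ-true (<-≤-trans (s≤s d≤2) 3≤k) = refl

step-3≤d : ∀ {k d} → k ≤ 2 → 3 ≤ d → step k d ≡ d
step-3≤d k≤2 3≤d rewrite <ᵇ-false (≤-trans k≤2 (≤-trans (n≤1+n 2) 3≤d)) = refl

step-≈₂ : ∀ {k k′ d d′} → k ≈₂ k′ → d ≈₂ d′ → step k d ≈₂ step k′ d′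
step-≈₂ (inj₁ refl) (inj₁ refl) = inj₁ refl
step-≈₂ {k} (inj₁ refl) (inj₂ (d≤2 , d′≤2)) with k ≤? 2
... | yes k≤2 = inj₂ (step-≤2 k≤2 d≤2 , step-≤2 k≤2 d′≤2)
... | no  k≰2 = inj₁ (trans (step-3≤k (≰⇒> k≰2) d≤2) (sym (step-3≤k (≰⇒> k≰2) d′≤2)))
step-≈₂ {d = d} (inj₂ (k≤2 , k′≤2)) (inj₁ refl) with d ≤? 2
... | yes d≤2 = inj₂ (step-≤2 k≤2 d≤2 , step-≤2 k′≤2 d≤2)
... | no  d≰2 = inj₁ (trans (step-3≤d k≤2 (≰⇒> d≰2)) (sym (step-3≤d k′≤2 (≰⇒> d≰2))))
step-≈₂ (inj₂ (k≤2 , k′≤2)) (inj₂ (d≤2 , d′≤2)) = inj₂ (step-≤2 k≤2 d≤2 , step-≤2 k′≤2 d′≤2)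

≈₂-≤ᵇ2 : ∀ {k k′} → k ≈₂ k′ → (k ≤ᵇ 2) ≡ (k′ ≤ᵇ 2)
≈₂-≤ᵇ2 (inj₁ refl) = refl
≈₂-≤ᵇ2 (inj₂ (k≤2 , k′≤2)) = trans (≤ᵇ-true k≤2) (sym (≤ᵇ-true k′≤2))

test-rotate : ∀ b d → ((d ≡ᵇ 2) ∧ b) ≡ ((rotate b d ≡ᵇ 0) ∧ not (not b))
test-rotate true  0 = refl
test-rotate true  1 = refl
test-rotate true  2 = refl
test-rotate true  (suc (suc (suc _))) = refl
test-rotate false 0 = refl
test-rotate false 1 = refl
test-rotate false 2 = refl
test-rotate false (suc (suc (suc _))) = refl

scan-toggle : ∀ {c k k′} → IsLehmer c → k ≈₂ k′ → scan test₁₂₃ k c ≡ scan test₃₂₁ k′ (toggle c)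
scan-toggle []            _ = refl
scan-toggle (_ ∷ [])      _ = refl
scan-toggle (_ ∷ _ ∷ [])  _ = refl
scan-toggle {d ∷ ds@(_ ∷ _ ∷ _)} {k} {k′} (_ ∷ c) k≈k′ =
  cong₂ _∨_ here≡ (scan-toggle c (step-≈₂ k≈k′ (rotate-≈₂ (bottomDescent ds) d)))
  where
  here≡ : test₁₂₃ k d ds ≡ test₃₂₁ k′ (rotate (bottomDescent ds) d) (toggle ds)
  here≡ rewrite length-toggle ds | bottomDescent-toggle c (s≤s (s≤s z≤n)) | ≈₂-≤ᵇ2 k≈k′
              | test-rotate (bottomDescent ds) d = refl


-- What the scans detect

record Cut (P : ℕ → Set) (x : ℕ) (Rest : List ℕ → Set) (L : List ℕ) : Set where
  constructor cut
  field
    {front back} : List ℕ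
    L≡        : L ≡ front ++ x ∷ back
    all-front : All P front
    rest      : Rest back

Cut-map : ∀ {P Q x R S L} → (∀ {v} → P v → Q v) → (∀ {B} → R B → S B) → Cut P x R L → Cut Q x S L
Cut-map f g (cut L≡ P-front rest) = cut L≡ (All.map f P-front) (g rest)

first-below : ∀ {t c} L → countBelow t L ≡ suc c → ∃ λ x → x < t × Cut (t ≤_) x (λ B → countBelow t B ≡ c) L
first-below {t} (x ∷ L) c≡ with x <? t
... | yes x<t = x , x<t , cut refl [] (suc-injective (trans (sym (countBelow-∷-< L x<t)) c≡))
... | no  x≮t with first-below L (trans (sym (countBelow-∷-≥ L (≮⇒≥ x≮t))) c≡)
...   | y , y<t , cut L≡ t≤front rest = y , y<t , cut (cong (x ∷_) L≡) (≮⇒≥ x≮t ∷ t≤front) rest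

Two : (ℕ → Set) → ℕ → ℕ → List ℕ → Set
Two P x y = Cut P x (Cut P y (All P))

two-below : ∀ {t} L → countBelow t L ≡ 2 → ∃₂ λ x y → x < t × y < t × Two (t ≤_) x y L
two-below L c≡2 with first-below L c≡2
... | x , x<t , cut {back = B} L≡ t≤front c≡1 with first-below B c≡1
...   | y , y<t , two = x , y , x<t , y<t , cut L≡ t≤front (Cut-map id (countBelow-none⁻ _) two)

module _ {P : ℕ → Set} {x y : ℕ} where

  Two-map : ∀ {Q : ℕ → Set} {L} → (∀ {v} → P v → Q v) → Two P x y L → Two Q x y L
  Two-map f = Cut-map f (Cut-map f (All.map f))

  Two-refine : ∀ {Q R : ℕ → Set} {L} → All Q L → (∀ {v} → Q v → P v → R v) → Two P x y L → Two R x y L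
  Two-refine {Q} {R} QL f (cut {C} refl PC (cut {B} refl PB PA))
    with QC , _ ∷ QBA ← All.++⁻ C QL
    with QB , _ ∷ QA  ← All.++⁻ B QBA
    = cut refl (refine QC PC) (cut refl (refine QB PB) (refine QA PA))
    where
    refine : ∀ {M} → All Q M → All P M → All R M
    refine QM PM = All.zipWith (uncurry f) (QM , PM)

  Two-all : ∀ {L} → P x → P y → Two P x y L → All P L
  Two-all Px Py (cut refl PC (cut refl PB PA)) = All.++⁺ PC (Px ∷ All.++⁺ PB (Py ∷ PA))

  Two-length : ∀ {L} → Two P x y L → 2 ≤ length L
  Two-length (cut {C} refl _ (cut {B} {A} refl _ _)) = begin
    2                                    ≤⟨ s≤s (s≤s z≤n) ⟩
    suc (suc (length A))                 ≤⟨ s≤s (m≤n+m _ (length B)) ⟩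
    suc (length B + suc (length A))      ≡⟨ cong suc (sym (length-++ B)) ⟩
    length (x ∷ B ++ y ∷ A)              ≤⟨ m≤n+m _ (length C) ⟩
    length C + length (x ∷ B ++ y ∷ A)   ≡⟨ sym (length-++ C) ⟩
    length (C ++ x ∷ B ++ y ∷ A)         ∎
    where open ≤-Reasoning

  Two-distinct : ∀ {L} → Unique L → Two P x y L → x ≢ y
  Two-distinct L! (cut {C} refl _ (cut {B} refl _ _)) with unique-++ʳ C L!
  ... | x≢ ∷ _ = All.lookup x≢ (∈-++⁺ʳ B (here refl))

  Two-∈ˡ : ∀ {L} → Two P x y L → x ∈ L
  Two-∈ˡ (cut {C} refl _ _) = ∈-++⁺ʳ C (here refl)

  Two-∈ʳ : ∀ {L} → Two P x y L → y ∈ L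
  Two-∈ʳ (cut {C} refl _ (cut {B} refl _ _)) = ∈-++⁺ʳ C (there (∈-++⁺ʳ B (here refl)))

countBelow-Two : ∀ {t x y L} → Two (t ≤_) x y L → countBelow t L ≡ countBelow t (x ∷ y ∷ [])
countBelow-Two {t} {x} {y} (cut refl t≤C (cut refl t≤B t≤A)) =
  trans (countBelow-++-none _ t≤C)
        (countBelow-∷-cong {t} x (trans (countBelow-++-none _ t≤B) (countBelow-∷-cong {t} y (countBelow-none _ t≤A))))

countBelow-pair : ∀ {t x y} → x < t → y < t → countBelow t (x ∷ y ∷ []) ≡ 2
countBelow-pair {y = y} x<t y<t = trans (countBelow-∷-< (y ∷ []) x<t) (cong suc (countBelow-∷-< [] y<t))

bottomDescent-lehmer : ∀ {t x y L} → x < t → y < t → Two (t ≤_) x y L → bottomDescent (lehmer L) ≡ (y <ᵇ x)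
bottomDescent-lehmer {t} {x} {y} x<t y<t (cut {[]} refl [] (cut {B} {A} refl t≤B t≤A))
  rewrite countBelow-++-none (y ∷ A) (All.map (≤-trans (<⇒≤ x<t)) t≤B)
        | countBelow-∷-cong {x} y {A} {[]} (countBelow-none A (All.map (≤-trans (<⇒≤ x<t)) t≤A))
  with y <? x
... | yes y<x rewrite <ᵇ-true y<x = refl
... | no  y≮x rewrite <ᵇ-false (≮⇒≥ y≮x) = refl
bottomDescent-lehmer {t} {x} {y} x<t y<t (cut {c ∷ C} {R} refl (t≤c ∷ t≤C) two) =
  trans (skip (≤-trans 2≤ (countBelow-mono L′ t≤c))) (bottomDescent-lehmer x<t y<t (cut refl t≤C two))
  where
  L′ = C ++ x ∷ R
  skip : ∀ {d ds} → 2 ≤ d → bottomDescent (d ∷ ds) ≡ bottomDescent ds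
  skip (s≤s (s≤s _)) = refl
  2≤ : 2 ≤ countBelow t L′
  2≤ = ≤-reflexive (sym (trans (countBelow-Two (cut refl t≤C two)) (countBelow-pair x<t y<t)))

maximum : List ℕ → ℕ
maximum = foldr _⊔_ 0

≤-maximum : ∀ {w u} → w ∈ u → w ≤ maximum u
≤-maximum {u = x ∷ u} (here refl) = m≤m⊔n x (maximum u)
≤-maximum {u = x ∷ u} (there w∈) = ≤-trans (≤-maximum w∈) (m≤n⊔m x (maximum u))

maximum-≤ : ∀ {t u} → All (_≤ t) u → maximum u ≤ t
maximum-≤ []           = z≤n
maximum-≤ (x≤t ∷ u≤t) = ⊔-lub x≤t (maximum-≤ u≤t)

maximum-∷ʳ : ∀ u s → maximum (u ∷ʳ s) ≡ maximum u ⊔ s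
maximum-∷ʳ []      s = ⊔-identityʳ s
maximum-∷ʳ (x ∷ u) s = trans (cong (x ⊔_) (maximum-∷ʳ u s)) (sym (⊔-assoc x (maximum u) s))

∃countBelow≡2 : ∀ {L} → Unique L → 2 ≤ length L → ∃ λ t → countBelow t L ≡ 2
∃countBelow≡2 {L} L! 2≤len =
  go (suc (maximum L)) (subst (2 ≤_) (sym (countBelow-all L (All.tabulate (s≤s ∘ ≤-maximum)))) 2≤len)
  where
  go : ∀ T → 2 ≤ countBelow T L → ∃ λ t → countBelow t L ≡ 2
  go zero 2≤ = contradiction (subst (2 ≤_) (countBelow-none L (All.tabulate (λ _ → z≤n))) 2≤) (λ ())
  go (suc T) 2≤ with 2 ≤? countBelow T L
  ... | yes 2≤′ = go T 2≤′
  ... | no  2≰  = suc T , ≤-antisym (≤-trans (countBelow-suc L!) (s≤s (s≤s⁻¹ (≰⇒> 2≰)))) 2≤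

step-countBelow : ∀ u s rest →
  step (countBelow (maximum u) (s ∷ rest)) (countBelow s rest) ≡ countBelow (maximum (u ∷ʳ s)) rest
step-countBelow u s rest rewrite maximum-∷ʳ u s with s <? maximum u
... | yes s<M rewrite countBelow-∷-< rest s<M
                    | <ᵇ-true (s≤s (countBelow-mono rest (<⇒≤ s<M)))
                    | m≥n⇒m⊔n≡m (<⇒≤ s<M) = refl
... | no  s≮M rewrite countBelow-∷-≥ rest (≮⇒≥ s≮M)
                    | <ᵇ-false (countBelow-mono rest (≮⇒≥ s≮M))
                    | m≤n⇒m⊔n≡n (≮⇒≥ s≮M) = refl

record Split (Local : List ℕ → ℕ → List ℕ → Set) (u σ : List ℕ) : Set where
  constructor split
  field
    {pre post} : List ℕ
    {pivot}    : ℕ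
    σ≡         : σ ≡ pre ++ pivot ∷ post
    local      : Local (u ++ pre) pivot post

module _ (test : ℕ → ℕ → List ℕ → Bool) (Local : List ℕ → ℕ → List ℕ → Set)
         (test⇔ : ∀ u s rest → Unique (u ++ s ∷ rest) →
                  T (test (countBelow (maximum u) (s ∷ rest)) (countBelow s rest) (lehmer rest)) ⇔ Local u s rest)
         where

  scan⇔ : ∀ u σ → Unique (u ++ σ) → T (scan test (countBelow (maximum u) σ) (lehmer σ)) ⇔ Split Local u σ
  scan⇔ u []         _  = mk⇔ (λ ()) λ { (split {[]} () _) ; (split {_ ∷ _} () _) }
  scan⇔ u (s ∷ rest) u! = mk⇔ to from
    where
    k = countBelow (maximum u) (s ∷ rest)
    d = countBelow s rest
    ih = scan⇔ (u ∷ʳ s) rest (subst Unique (sym (++-assoc u (s ∷ []) rest)) u!)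
    Local[_] : List ℕ → Set
    Local[ v ] = Local v s rest
    to : T (test k d (lehmer rest) ∨ scan test (step k d) (lehmer rest)) → Split Local u (s ∷ rest)
    to t with Equivalence.to T-∨ t
    ... | inj₁ h = split {pre = []} refl (subst Local[_] (sym (++-identityʳ u)) (Equivalence.to (test⇔ u s rest u!) h))
    ... | inj₂ h with Equivalence.to ih (subst (λ k′ → T (scan test k′ (lehmer rest))) (step-countBelow u s rest) h)
    ...   | split σ≡ local = split (cong (s ∷_) σ≡) (subst (λ v → Local v _ _) (++-assoc u (s ∷ []) _) local)
    from : Split Local u (s ∷ rest) → T (test k d (lehmer rest) ∨ scan test (step k d) (lehmer rest))
    from (split {[]} refl local) =
      Equivalence.from T-∨ (inj₁ (Equivalence.from (test⇔ u s rest u!) (subst Local[_] (++-identityʳ u) local)))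
    from (split {_ ∷ pre} refl local) =
      Equivalence.from T-∨ (inj₂ (subst (λ k′ → T (scan test k′ (lehmer rest))) (sym (step-countBelow u s rest))
        (Equivalence.from ih (split refl (subst (λ v → Local v _ _) (sym (++-assoc u (s ∷ []) pre)) local)))))

unique-pivot : ∀ {A : Set} (u : List A) {s rest} → Unique (u ++ s ∷ rest) → s ∉ u × All (s ≢_) rest × Unique rest
unique-pivot u {s} u! with unique-++ʳ u u!
... | s≢rest ∷ rest! = (λ s∈u → unique-++-disjoint u! s∈u (here refl)) , s≢rest , rest!

Local₁₂₃ : List ℕ → ℕ → List ℕ → Set
Local₁₂₃ u s rest = All (_< s) u × ∃₂ λ q p → p < q × q < s × Two (s <_) q p rest

Local₃₂₁ : List ℕ → ℕ → List ℕ → Set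
Local₃₂₁ u s rest = ∃₂ λ b c → s < b × b < c × All (_< c) u × Two (c <_) b c rest

T-test₁₂₃ : ∀ k d ds → T (test₁₂₃ k d ds) ⇔ (2 ≤ length ds × k ≤ 2 × d ≡ 2 × T (bottomDescent ds))
T-test₁₂₃ k d ds = mk⇔
  (λ t → let (l , t₁) = to T-∧ t; (k≤ , t₂) = to T-∧ t₁; (d≡ , b) = to T-∧ t₂
         in ≤ᵇ⇒≤ 2 (length ds) l , ≤ᵇ⇒≤ k 2 k≤ , ≡ᵇ⇒≡ d 2 d≡ , b)
  (λ (l , k≤ , d≡ , b) → from T-∧ (≤⇒≤ᵇ l , from T-∧ (≤⇒≤ᵇ k≤ , from T-∧ (≡⇒≡ᵇ d 2 d≡ , b))))
  where open Equivalence

T-test₃₂₁ : ∀ k d ds → T (test₃₂₁ k d ds) ⇔ (2 ≤ length ds × k ≤ 2 × d ≡ 0 × ¬ T (bottomDescent ds))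
T-test₃₂₁ k d ds = mk⇔
  (λ t → let (l , t₁) = to T-∧ t; (k≤ , t₂) = to T-∧ t₁; (d≡ , b) = to T-∧ t₂
         in ≤ᵇ⇒≤ 2 (length ds) l , ≤ᵇ⇒≤ k 2 k≤ , ≡ᵇ⇒≡ d 0 d≡ , not⇒¬T b)
  (λ (l , k≤ , d≡ , b) → from T-∧ (≤⇒≤ᵇ l , from T-∧ (≤⇒≤ᵇ k≤ , from T-∧ (≡⇒≡ᵇ d 0 d≡ , ¬T⇒not b))))
  where open Equivalence

below-maximum : ∀ {u t} L → countBelow (maximum u) L ≤ 2 → 3 ≤ countBelow (suc t) L → All (_≤ t) u
below-maximum L k≤2 3≤ = All.tabulate λ w∈ → ≮⇒≥ λ t<w →
  <-irrefl refl (≤-trans 3≤ (≤-trans (countBelow-mono L (≤-trans t<w (≤-maximum w∈))) k≤2))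

≤∧∉⇒< : ∀ {t u} → All (_≤ t) u → t ∉ u → All (_< t) u
≤∧∉⇒< []           _   = []
≤∧∉⇒< (w≤t ∷ u≤t) t∉ = ≤∧≢⇒< w≤t (λ w≡t → t∉ (here (sym w≡t))) ∷ ≤∧∉⇒< u≤t (t∉ ∘ there)

test₁₂₃-sound : ∀ u s rest → Unique (u ++ s ∷ rest) →
  T (test₁₂₃ (countBelow (maximum u) (s ∷ rest)) (countBelow s rest) (lehmer rest)) → Local₁₂₃ u s rest
test₁₂₃-sound u s rest u! t
  with _ , k≤2 , d≡2 , desc ← Equivalence.to (T-test₁₂₃ _ _ (lehmer rest)) t
  with q , p , q<s , p<s , two ← two-below rest d≡2
  = ≤∧∉⇒< (below-maximum (s ∷ rest) k≤2 3≤) s∉u , q , p , p<q , q<s ,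
    Two-refine s≢rest (λ s≢v s≤v → ≤∧≢⇒< s≤v s≢v) two
  where
  open ≤-Reasoning
  s∉u = proj₁ (unique-pivot u u!)
  s≢rest = proj₁ (proj₂ (unique-pivot u u!))
  p<q : p < q
  p<q = <ᵇ⇒< p q (subst T (bottomDescent-lehmer q<s p<s two) desc)
  3≤ : 3 ≤ countBelow (suc s) (s ∷ rest)
  3≤ = begin
    3                              ≡⟨ cong suc (sym d≡2) ⟩
    suc (countBelow s rest)        ≤⟨ s≤s (countBelow-mono rest (n≤1+n s)) ⟩
    suc (countBelow (suc s) rest)  ≡⟨ sym (countBelow-∷-< rest ≤-refl) ⟩
    countBelow (suc s) (s ∷ rest)  ∎

test₁₂₃-complete : ∀ {u s rest} → Local₁₂₃ u s rest →
  T (test₁₂₃ (countBelow (maximum u) (s ∷ rest)) (countBelow s rest) (lehmer rest))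
test₁₂₃-complete {u} {s} {rest} (u<s , q , p , p<q , q<s , two) =
  Equivalence.from (T-test₁₂₃ _ _ (lehmer rest)) (len , k≤2 , d≡2 , desc)
  where
  open ≤-Reasoning
  p<s = <-trans p<q q<s
  two≤ = Two-map <⇒≤ two
  d≡2 : countBelow s rest ≡ 2
  d≡2 = trans (countBelow-Two two≤) (countBelow-pair q<s p<s)
  len = subst (2 ≤_) (sym (length-lehmer rest)) (Two-length two)
  k≤2 = begin
    countBelow (maximum u) (s ∷ rest)  ≤⟨ countBelow-mono (s ∷ rest) (maximum-≤ (All.map <⇒≤ u<s)) ⟩
    countBelow s (s ∷ rest)            ≡⟨ countBelow-∷-≥ rest ≤-refl ⟩
    countBelow s rest                  ≡⟨ d≡2 ⟩
    2                                  ∎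
  desc = subst T (sym (bottomDescent-lehmer q<s p<s two≤)) (<⇒<ᵇ p<q)

test₃₂₁-sound : ∀ u s rest → Unique (u ++ s ∷ rest) →
  T (test₃₂₁ (countBelow (maximum u) (s ∷ rest)) (countBelow s rest) (lehmer rest)) → Local₃₂₁ u s rest
test₃₂₁-sound u s rest u! t
  with len , k≤2 , d≡0 , ¬desc ← Equivalence.to (T-test₃₂₁ _ _ (lehmer rest)) t
  with _ , s≢rest , rest! ← unique-pivot u u!
  with _ , c≡2 ← ∃countBelow≡2 rest! (subst (2 ≤_) (length-lehmer rest) len)
  with x , y , x<t , y<t , two ← two-below rest c≡2
  = x , y , s<x , x<y , ≤∧∉⇒< (below-maximum (s ∷ rest) k≤2 3≤) y∉u , Two-map (<-≤-trans y<t) two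
  where
  open ≤-Reasoning
  s<rest : All (s <_) rest
  s<rest = All.zipWith (λ (s≤v , s≢v) → ≤∧≢⇒< s≤v s≢v) (countBelow-none⁻ rest d≡0 , s≢rest)
  x<y : x < y
  x<y = ≤∧≢⇒< (≮⇒≥ (λ y<x → ¬desc (subst T (sym (bottomDescent-lehmer x<t y<t two)) (<⇒<ᵇ y<x))))
              (Two-distinct rest! two)
  s<x = All.lookup s<rest (Two-∈ˡ two)
  y∉u : y ∉ u
  y∉u y∈u = unique-++-disjoint u! y∈u (there (Two-∈ʳ two))
  3≤ : 3 ≤ countBelow (suc y) (s ∷ rest)
  3≤ = begin
    3                                        ≡⟨ cong suc (sym (countBelow-pair (m<n⇒m<1+n x<y) ≤-refl)) ⟩
    suc (countBelow (suc y) (x ∷ y ∷ []))    ≡⟨ cong suc (sym (countBelow-Two (Two-map (≤-trans y<t) two))) ⟩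
    suc (countBelow (suc y) rest)            ≡⟨ sym (countBelow-∷-< rest (m<n⇒m<1+n (<-trans s<x x<y))) ⟩
    countBelow (suc y) (s ∷ rest)            ∎

test₃₂₁-complete : ∀ {u s rest} → Local₃₂₁ u s rest →
  T (test₃₂₁ (countBelow (maximum u) (s ∷ rest)) (countBelow s rest) (lehmer rest))
test₃₂₁-complete {u} {s} {rest} (b , c , s<b , b<c , u<c , two) =
  Equivalence.from (T-test₃₂₁ _ _ (lehmer rest)) (len , k≤2 , d≡0 , ¬desc)
  where
  open ≤-Reasoning
  s<c = <-trans s<b b<c
  len = subst (2 ≤_) (sym (length-lehmer rest)) (Two-length two)
  d≡0 = countBelow-none rest (Two-all (<⇒≤ s<b) (<⇒≤ s<c) (Two-map (λ c<v → <⇒≤ (<-trans s<c c<v)) two))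
  k≤2 = begin
    countBelow (maximum u) (s ∷ rest)  ≤⟨ countBelow-mono (s ∷ rest) (maximum-≤ (All.map <⇒≤ u<c)) ⟩
    countBelow c (s ∷ rest)            ≡⟨ countBelow-∷-< rest s<c ⟩
    suc (countBelow c rest)            ≡⟨ cong suc (countBelow-Two (Two-map <⇒≤ two)) ⟩
    suc (countBelow c (b ∷ c ∷ []))    ≡⟨ cong suc (countBelow-∷-< (c ∷ []) b<c) ⟩
    suc (suc (countBelow c (c ∷ [])))  ≡⟨ cong (suc ∘ suc) (countBelow-∷-≥ {c} [] ≤-refl) ⟩
    2                                  ∎
  ¬desc = λ desc → subst T (trans (bottomDescent-lehmer (m<n⇒m<1+n b<c) ≤-refl two) (<ᵇ-false (<⇒≤ b<c))) desc

test₁₂₃⇔ : ∀ u s rest → Unique (u ++ s ∷ rest) →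
  T (test₁₂₃ (countBelow (maximum u) (s ∷ rest)) (countBelow s rest) (lehmer rest)) ⇔ Local₁₂₃ u s rest
test₁₂₃⇔ u s rest u! = mk⇔ (test₁₂₃-sound u s rest u!) test₁₂₃-complete

test₃₂₁⇔ : ∀ u s rest → Unique (u ++ s ∷ rest) →
  T (test₃₂₁ (countBelow (maximum u) (s ∷ rest)) (countBelow s rest) (lehmer rest)) ⇔ Local₃₂₁ u s rest
test₃₂₁⇔ u s rest u! = mk⇔ (test₃₂₁-sound u s rest u!) test₃₂₁-complete

Three : (P₀ P₁ P₂ P₃ : ℕ → Set) → ℕ → ℕ → ℕ → List ℕ → Set
Three P₀ P₁ P₂ P₃ x y z = Cut P₀ x (Cut P₁ y (Cut P₂ z (All P₃)))

-- Occ₁₂₃ (reverse π) and Occ₃₂₁ (reverse π) say that π contains (123,R₃), resp. (321,R₃).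
Occ₁₂₃ : List ℕ → Set
Occ₁₂₃ σ = ∃ λ ((s , q , p) : ℕ × ℕ × ℕ) → (p < q × q < s) × Three (_< s) (s <_) (s <_) (s <_) s q p σ

Occ₃₂₁ : List ℕ → Set
Occ₃₂₁ σ = ∃ λ ((s , b , c) : ℕ × ℕ × ℕ) → (s < b × b < c) × Three (_< c) (c <_) (c <_) (c <_) s b c σ

scan₁₂₃⇔ : ∀ {σ} → Unique σ → T (scan test₁₂₃ 0 (lehmer σ)) ⇔ Occ₁₂₃ σ
scan₁₂₃⇔ {σ} σ! =
  subst (λ k → T (scan test₁₂₃ k (lehmer σ)) ⇔ Occ₁₂₃ σ) (countBelow-none σ (All.tabulate λ _ → z≤n))
  (⇔.trans (scan⇔ test₁₂₃ Local₁₂₃ test₁₂₃⇔ [] σ σ!) (mk⇔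
    (λ { (split σ≡ (u<s , q , p , p<q , q<s , two)) → (_ , q , p) , (p<q , q<s) , cut σ≡ u<s two })
    (λ { ((s , q , p) , (p<q , q<s) , cut σ≡ u<s two) → split σ≡ (u<s , q , p , p<q , q<s , two) })))

scan₃₂₁⇔ : ∀ {σ} → Unique σ → T (scan test₃₂₁ 0 (lehmer σ)) ⇔ Occ₃₂₁ σ
scan₃₂₁⇔ {σ} σ! =
  subst (λ k → T (scan test₃₂₁ k (lehmer σ)) ⇔ Occ₃₂₁ σ) (countBelow-none σ (All.tabulate λ _ → z≤n))
  (⇔.trans (scan⇔ test₃₂₁ Local₃₂₁ test₃₂₁⇔ [] σ σ!) (mk⇔
    (λ { (split σ≡ (b , c , s<b , b<c , u<c , two)) → (_ , b , c) , (s<b , b<c) , cut σ≡ u<c two })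
    (λ { ((s , b , c) , (s<b , b<c) , cut σ≡ u<c two) → split σ≡ (b , c , s<b , b<c , u<c , two) })))


-- Occurrences of a length-3 mesh pattern

drop-length-++ : ∀ (F : List ℕ) {R} → drop (length F) (F ++ R) ≡ R
drop-length-++ []      = refl
drop-length-++ (_ ∷ F) = drop-length-++ F

at-drop : ∀ o L m → at L (suc (o + m)) ≡ at (drop o L) (suc m)
at-drop zero    L       m = refl
at-drop (suc o) []      m = refl
at-drop (suc o) (x ∷ L) m = at-drop o L m

prefix⇔ : ∀ {Q : ℕ → Set} S {B} → (∀ m → m < length S → Q (at (S ++ B) (suc m))) ⇔ All Q S
prefix⇔ []      = mk⇔ (λ _ → []) (λ _ _ ())
prefix⇔ (s ∷ S) = mk⇔
  (λ h → h 0 (s≤s z≤n) ∷ Equivalence.to (prefix⇔ S) (λ m m< → h (suc m) (s≤s m<)))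
  (λ { (q ∷ qs) zero _ → q ; (q ∷ qs) (suc m) m< → Equivalence.from (prefix⇔ S) qs m (s≤s⁻¹ m<) })

segment⇔ : ∀ {Q : ℕ → Set} L o S {B} → drop o L ≡ S ++ B →
           (∀ m → o < m → m < suc (o + length S) → Q (at L m)) ⇔ All Q S
segment⇔ {Q} L o S eq = mk⇔
  (λ h → Equivalence.to (prefix⇔ S) λ m m< →
     subst Q (trans (at-drop o L m) (cong (λ L′ → at L′ (suc m)) eq))
             (h (suc (o + m)) (s≤s (m≤m+n o m)) (s≤s (+-monoʳ-< o m<))))
  (λ QS m o<m m< → from QS m o<m m<)
  where
  from : All Q S → ∀ m → o < m → m < suc (o + length S) → Q (at L m)
  from QS m o<m m< with m′ , refl ← m≤n⇒∃[o]m+o≡n o<m =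
    subst Q (sym (trans (at-drop o L m′) (cong (λ L′ → at L′ (suc m′)) eq)))
            (Equivalence.from (prefix⇔ S) QS m′ (+-cancelˡ-< o m′ (length S) (s≤s⁻¹ m<)))

-- The values in row b of the mesh diagram of an occurrence with values vs.
InBand : ℕ → List ℕ → ℕ → ℕ → Set
InBand n vs b v = bnd n vs b < v × v < bnd n vs (suc b)

boxEmpty⇔ : ∀ π is a b → bnd (length π) is (suc a) ≤ suc (length π) →
  T (boxEmpty π is (a , b)) ⇔
  (∀ m → bnd (length π) is a < m → m < bnd (length π) is (suc a) →
         ¬ InBand (length π) (isort (map (at π) is)) b (at π m))
boxEmpty⇔ π is a b hi≤ = mk⇔
  (λ t m lo<m m<hi (v₁ , v₂) → not⇒¬T t (any⁺ test (lose (Equivalence.from ∈-range1 (range m lo<m m<hi))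
     (Equivalence.from T-∧ (<⇒<ᵇ lo<m ,
      Equivalence.from T-∧ (<⇒<ᵇ m<hi , Equivalence.from T-∧ (<⇒<ᵇ v₁ , <⇒<ᵇ v₂)))))))
  (λ h → ¬T⇒not λ t → let (m , _ , tm) = find (any⁻ test (range1 n) t)
                          (lo<m , r₁) = Equivalence.to T-∧ tm
                          (m<hi , r₂) = Equivalence.to T-∧ r₁
                          (v₁ , v₂)   = Equivalence.to T-∧ r₂
                      in h m (<ᵇ⇒< _ _ lo<m) (<ᵇ⇒< _ _ m<hi) (<ᵇ⇒< _ _ v₁ , <ᵇ⇒< _ _ v₂))
  where
  n = length π
  vs = isort (map (at π) is)
  test : ℕ → Bool
  test m = (bnd n is a <ᵇ m) ∧ (m <ᵇ bnd n is (suc a)) ∧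
           (bnd n vs b <ᵇ at π m) ∧ (at π m <ᵇ bnd n vs (suc b))
  range : ∀ m → bnd n is a < m → m < bnd n is (suc a) → InRange n m
  range m lo<m m<hi = ≤-trans (s≤s z≤n) lo<m , s≤s⁻¹ (<-≤-trans m<hi hi≤)

drop-cut : ∀ o {L : List ℕ} F {x R} → drop o L ≡ F ++ x ∷ R → drop (o + length F) L ≡ x ∷ R
drop-cut o {L} F eq = trans (sym (drop-drop o (length F) L)) (trans (cong (drop (length F)) eq) (drop-length-++ F))

drop-suc : ∀ o {L : List ℕ} {x R} → drop o L ≡ x ∷ R → drop (suc o) L ≡ R
drop-suc zero    {_ ∷ _} refl = refl
drop-suc (suc o) {_ ∷ L} eq   = drop-suc o {L} eq

at-drop-head : ∀ o {L : List ℕ} {x R} → drop o L ≡ x ∷ R → at L (suc o) ≡ x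
at-drop-head zero    {_ ∷ _} refl = refl
at-drop-head (suc o) {_ ∷ L} eq   = at-drop-head o {L} eq

length-drop-head : ∀ o {L : List ℕ} {x R} → drop o L ≡ x ∷ R → length L ≡ suc (o + length R)
length-drop-head zero    {_ ∷ _} refl = refl
length-drop-head (suc o) {_ ∷ L} eq   = cong suc (length-drop-head o {L} eq)

module ThreeCut {π A₀ R₀ A₁ R₁ A₂ A₃ : List ℕ} {x y z : ℕ}
  (eq₀ : π ≡ A₀ ++ x ∷ R₀) (eq₁ : R₀ ≡ A₁ ++ y ∷ R₁) (eq₂ : R₁ ≡ A₂ ++ z ∷ A₃) where

  i = suc (length A₀)
  j = suc (i + length A₁)
  k = suc (j + length A₂)

  x-drop : drop (length A₀) π ≡ x ∷ R₀
  x-drop = drop-cut 0 {π} A₀ eq₀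
  drop-i : drop i π ≡ A₁ ++ y ∷ R₁
  drop-i = trans (drop-suc (length A₀) {π} x-drop) eq₁
  y-drop : drop (i + length A₁) π ≡ y ∷ R₁
  y-drop = drop-cut i {π} A₁ drop-i
  drop-j : drop j π ≡ A₂ ++ z ∷ A₃
  drop-j = trans (drop-suc (i + length A₁) {π} y-drop) eq₂
  z-drop : drop (j + length A₂) π ≡ z ∷ A₃
  z-drop = drop-cut j {π} A₂ drop-j
  drop-k : drop k π ≡ A₃ ++ []
  drop-k = trans (drop-suc (j + length A₂) {π} z-drop) (sym (++-identityʳ A₃))

  length-π : length π ≡ k + length A₃
  length-π = length-drop-head (j + length A₂) {π} z-drop

  i<j : i < j
  i<j = s≤s (m≤m+n i (length A₁))
  j<k : j < k
  j<k = s≤s (m≤m+n j (length A₂))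
  k≤n : k ≤ length π
  k≤n = subst (k ≤_) (sym length-π) (m≤m+n k (length A₃))

  at-ijk : map (at π) (i ∷ j ∷ k ∷ []) ≡ x ∷ y ∷ z ∷ []
  at-ijk = cong₂ _∷_ (at-drop-head (length A₀) {π} x-drop)
          (cong₂ _∷_ (at-drop-head (i + length A₁) {π} y-drop)
          (cong₂ _∷_ (at-drop-head (j + length A₂) {π} z-drop) refl))

module _ {P₀ P₁ P₂ P₃ : ℕ → Set} {x y z : ℕ} {π : List ℕ} where

  positions : Three P₀ P₁ P₂ P₃ x y z π → List ℕ
  positions (cut eq₀ _ (cut eq₁ _ (cut eq₂ _ _))) = i ∷ j ∷ k ∷ []
    where open ThreeCut eq₀ eq₁ eq₂

  segment : Three P₀ P₁ P₂ P₃ x y z π → ℕ → List ℕ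
  segment (cut {A₀} _ _ _)                              0 = A₀
  segment (cut _ _ (cut {A₁} _ _ _))                    1 = A₁
  segment (cut _ _ (cut _ _ (cut {A₂} _ _ _)))          2 = A₂
  segment (cut _ _ (cut _ _ (cut {back = A₃} _ _ _))) _ = A₃

  at-positions : (c : Three P₀ P₁ P₂ P₃ x y z π) → map (at π) (positions c) ≡ x ∷ y ∷ z ∷ []
  at-positions (cut eq₀ _ (cut eq₁ _ (cut eq₂ _ _))) = ThreeCut.at-ijk eq₀ eq₁ eq₂

  box⇔ : (c : Three P₀ P₁ P₂ P₃ x y z π) → ∀ a b → a ≤ 3 →
         T (boxEmpty π (positions c) (a , b)) ⇔
         All (λ v → ¬ InBand (length π) (isort (x ∷ y ∷ z ∷ [])) b v) (segment c a)
  box⇔ c@(cut {A₀} eq₀ _ (cut {A₁} eq₁ _ (cut {A₂} {A₃} eq₂ _ _))) a b a≤3 =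
    subst (λ vs → T (boxEmpty π is (a , b)) ⇔ All (λ v → ¬ InBand n vs b v) (segment c a))
          (cong isort at-ijk) (by-segment a a≤3)
    where
    open ThreeCut eq₀ eq₁ eq₂
    n = length π
    is = i ∷ j ∷ k ∷ []
    Q : ℕ → Set
    Q v = ¬ InBand n (isort (map (at π) is)) b v
    by-segment : ∀ a → a ≤ 3 → T (boxEmpty π is (a , b)) ⇔ All Q (segment c a)
    by-segment 0 _ = ⇔.trans (boxEmpty⇔ π is 0 b (≤-trans (<⇒≤ (<-≤-trans (<-trans i<j j<k) k≤n)) (n≤1+n n)))
                             (segment⇔ π 0 A₀ eq₀)
    by-segment 1 _ = ⇔.trans (boxEmpty⇔ π is 1 b (≤-trans (<⇒≤ (<-≤-trans j<k k≤n)) (n≤1+n n)))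
                             (segment⇔ π i A₁ drop-i)
    by-segment 2 _ = ⇔.trans (boxEmpty⇔ π is 2 b (≤-trans k≤n (n≤1+n n)))
                             (segment⇔ π j A₂ drop-j)
    by-segment 3 _ = ⇔.trans (boxEmpty⇔ π is 3 b ≤-refl)
                             (subst (λ h → (∀ m → k < m → m < h → Q (at π m)) ⇔ All Q A₃)
                                    (cong suc (sym length-π)) (segment⇔ π k A₃ drop-k))
    by-segment (suc (suc (suc (suc _)))) (s≤s (s≤s (s≤s ())))

take-at-drop : ∀ o (L : List ℕ) → o < length L → L ≡ take o L ++ at L (suc o) ∷ drop (suc o) L
take-at-drop zero    (x ∷ L) _   = refl
take-at-drop (suc o) (x ∷ L) o<n = cong (x ∷_) (take-at-drop o L (s≤s⁻¹ o<n))

length-take-< : ∀ o (L : List ℕ) → o < length L → length (take o L) ≡ o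
length-take-< zero    (x ∷ L) _   = refl
length-take-< (suc o) (x ∷ L) o<n = cong suc (length-take-< o L (s≤s⁻¹ o<n))

<-length-drop : ∀ p o (L : List ℕ) → p + o < length L → o < length (drop p L)
<-length-drop zero    o L       p+o<n = p+o<n
<-length-drop (suc p) o (x ∷ L) p+o<n = <-length-drop p o L (s≤s⁻¹ p+o<n)

cut-at-positions : ∀ {π i j k} → 1 ≤ i → i < j → j < k → k ≤ length π →
  ∃ λ ((x , y , z) : ℕ × ℕ × ℕ) → Σ (Three U U U U x y z π) λ c → positions c ≡ i ∷ j ∷ k ∷ []
cut-at-positions {π} {suc o₁} {j} {k} _ i<j j<k k≤n
  with o₂ , refl ← m≤n⇒∃[o]m+o≡n i<j
  with o₃ , refl ← m≤n⇒∃[o]m+o≡n j<k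
  = (at π i , at R₀ (suc o₂) , at R₁ (suc o₃)) ,
    cut eq₀ (All.tabulate _) (cut eq₁ (All.tabulate _) (cut eq₂ (All.tabulate _) (All.tabulate _))) ,
    cong₂ _∷_ (cong suc len₀) (cong₂ _∷_ (cong₂ (λ a b → suc (suc a + b)) len₀ len₁)
      (cong₂ _∷_ (cong₂ (λ ab c → suc (ab + c)) (cong₂ (λ a b → suc (suc a + b)) len₀ len₁) len₂) refl))
  where
  i = suc o₁
  j′ = suc (i + o₂)
  R₀ = drop i π
  R₁ = drop j′ π
  drop-j : drop (suc o₂) R₀ ≡ R₁
  drop-j = trans (drop-drop i (suc o₂) π) (cong (λ p → drop p π) (+-suc i o₂))
  o₁<n : o₁ < length π
  o₁<n = ≤-trans (<⇒≤ (<-trans (s≤s (m≤m+n i o₂)) (s≤s (m≤m+n j′ o₃)))) k≤n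
  o₂<R₀ : o₂ < length R₀
  o₂<R₀ = <-length-drop i o₂ π (≤-trans (<⇒≤ (s≤s (m≤m+n j′ o₃))) k≤n)
  o₃<R₁ : o₃ < length R₁
  o₃<R₁ = <-length-drop j′ o₃ π k≤n
  eq₀ = take-at-drop o₁ π o₁<n
  eq₁ = trans (take-at-drop o₂ R₀ o₂<R₀) (cong (λ R → take o₂ R₀ ++ at R₀ (suc o₂) ∷ R) drop-j)
  eq₂ = take-at-drop o₃ R₁ o₃<R₁
  len₀ = length-take-< o₁ π o₁<n
  len₁ = length-take-< o₂ R₀ o₂<R₀
  len₂ = length-take-< o₃ R₁ o₃<R₁

∈-incTuples : ∀ {n lo k is} → is ∈ incTuples n lo (suc k) ⇔
              ∃₂ λ i is′ → is ≡ i ∷ is′ × lo < i × i ≤ n × is′ ∈ incTuples n i k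
∈-incTuples {n} {lo} {k} {is} = mk⇔ to from
  where
  to : is ∈ incTuples n lo (suc k) → ∃₂ λ i is′ → is ≡ i ∷ is′ × lo < i × i ≤ n × is′ ∈ incTuples n i k
  to is∈ with find (∈-concatMap⁻ _ {xs = range1 n} is∈)
  ... | i , i∈ , is∈ᵢ with lo <ᵇ i in lo<ᵇi
  ...   | true with is′ , is′∈ , refl ← ∈-map⁻ (i ∷_) is∈ᵢ =
    i , is′ , refl , <ᵇ⇒< lo i (subst T (sym lo<ᵇi) _) , proj₂ (Equivalence.to ∈-range1 i∈) , is′∈
  from : (∃₂ λ i is′ → is ≡ i ∷ is′ × lo < i × i ≤ n × is′ ∈ incTuples n i k) → is ∈ incTuples n lo (suc k)
  -- The conditional in incTuples is local to Defs; ascribing the type of `enter` exposes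
  -- lo <ᵇ i to the with-abstraction.
  from (i , is′ , refl , lo<i , i≤n , is′∈)
    with lo <ᵇ i in lo<ᵇi
       | (i ∷ is′ ∈ _ → i ∷ is′ ∈ incTuples n lo (suc k))
           ∋ ∈-concatMap⁺ _ {xs = range1 n} ∘ lose (Equivalence.from ∈-range1 (≤-trans (s≤s z≤n) lo<i , i≤n))
  ... | true  | enter = enter (∈-map⁺ (i ∷_) is′∈)
  ... | false | _     = contradiction (subst T lo<ᵇi (<⇒<ᵇ lo<i)) id

module _ {P₀ P₁ P₂ P₃ : ℕ → Set} {x y z : ℕ} {π : List ℕ} where

  positions∈incTuples : (c : Three P₀ P₁ P₂ P₃ x y z π) → positions c ∈ incTuples (length π) 0 3
  positions∈incTuples (cut eq₀ _ (cut eq₁ _ (cut eq₂ _ _))) =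
    Equivalence.from (∈-incTuples {k = 2}) (i , _ , refl , s≤s z≤n , ≤-trans (<⇒≤ (<-trans i<j j<k)) k≤n ,
    Equivalence.from (∈-incTuples {k = 1}) (j , _ , refl , i<j , ≤-trans (<⇒≤ j<k) k≤n ,
    Equivalence.from (∈-incTuples {k = 0}) (k , _ , refl , j<k , k≤n , here refl)))
    where open ThreeCut eq₀ eq₁ eq₂

contains⇔cut : ∀ {a b c R π} →
  T (contains (mesh (a ∷ b ∷ c ∷ []) R) π) ⇔
  ∃ λ ((x , y , z) : ℕ × ℕ × ℕ) → Σ (Three U U U U x y z π) λ cu →
    T (isOccurrence (mesh (a ∷ b ∷ c ∷ []) R) π (positions cu))
contains⇔cut {a} {b} {c} {R} {π} = mk⇔ to from
  where
  p = mesh (a ∷ b ∷ c ∷ []) R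
  to : T (contains p π) → _
  to t with is , is∈ , occ ← find (any⁻ _ _ t)
       with i , _ , refl , 0<i , _ , is₁∈ ← Equivalence.to (∈-incTuples {length π} {0} {2}) is∈
       with j , _ , refl , i<j , _ , is₂∈ ← Equivalence.to (∈-incTuples {length π} {i} {1}) is₁∈
       with k , _ , refl , j<k , k≤n , here refl ← Equivalence.to (∈-incTuples {length π} {j} {0}) is₂∈
       with xyz , cu , pos≡ ← cut-at-positions 0<i i<j j<k k≤n
       = xyz , cu , subst (T ∘ isOccurrence p π) (sym pos≡) occ
  from : _ → T (contains p π)
  from (_ , cu , occ) = any⁺ _ (lose (positions∈incTuples cu) occ)


-- The four patterns

-- Abstracting the comparisons in the order in which orderIso evaluates them makes every other
-- combination compute to T false.
orderIso-123⁻ : ∀ {x y z} → T (orderIso (x ∷ y ∷ z ∷ []) p123) → x < y × y < z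
orderIso-123⁻ {x} {y} {z} with x <ᵇ x | x <ᵇ y in x<y | x <ᵇ z | y <ᵇ x | y <ᵇ y | y <ᵇ z in y<z
... | true  | _     | _     | _     | _     | _     = λ ()
... | false | false | _     | _     | _     | _     = λ ()
... | false | true  | false | _     | _     | _     = λ ()
... | false | true  | true  | true  | _     | _     = λ ()
... | false | true  | true  | false | true  | _     = λ ()
... | false | true  | true  | false | false | false = λ ()
... | false | true  | true  | false | false | true  =
  λ _ → <ᵇ⇒< x y (subst T (sym x<y) _) , <ᵇ⇒< y z (subst T (sym y<z) _)

orderIso-321⁻ : ∀ {x y z} → T (orderIso (x ∷ y ∷ z ∷ []) p321) → y < x × z < y
orderIso-321⁻ {x} {y} {z} with x <ᵇ x | x <ᵇ y | x <ᵇ z | y <ᵇ x in y<x | y <ᵇ y | y <ᵇ z | z <ᵇ x | z <ᵇ y in z<y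
... | true  | _     | _     | _     | _     | _     | _     | _     = λ ()
... | false | true  | _     | _     | _     | _     | _     | _     = λ ()
... | false | false | true  | _     | _     | _     | _     | _     = λ ()
... | false | false | false | false | _     | _     | _     | _     = λ ()
... | false | false | false | true  | true  | _     | _     | _     = λ ()
... | false | false | false | true  | false | true  | _     | _     = λ ()
... | false | false | false | true  | false | false | false | _     = λ ()
... | false | false | false | true  | false | false | true  | false = λ ()
... | false | false | false | true  | false | false | true  | true  =
  λ _ → <ᵇ⇒< y x (subst T (sym y<x) _) , <ᵇ⇒< z y (subst T (sym z<y) _)

orderIso-123⁺ : ∀ {x y z} → x < y → y < z → T (orderIso (x ∷ y ∷ z ∷ []) p123)
orderIso-123⁺ {x} {y} {z} x<y y<z
  rewrite <ᵇ-false (≤-refl {x}) | <ᵇ-false (≤-refl {y}) | <ᵇ-false (≤-refl {z})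
        | <ᵇ-true x<y | <ᵇ-true y<z | <ᵇ-true (<-trans x<y y<z)
        | <ᵇ-false (<⇒≤ x<y) | <ᵇ-false (<⇒≤ y<z) | <ᵇ-false (<⇒≤ (<-trans x<y y<z)) = _

orderIso-321⁺ : ∀ {x y z} → y < x → z < y → T (orderIso (x ∷ y ∷ z ∷ []) p321)
orderIso-321⁺ {x} {y} {z} y<x z<y
  rewrite <ᵇ-false (≤-refl {x}) | <ᵇ-false (≤-refl {y}) | <ᵇ-false (≤-refl {z})
        | <ᵇ-true y<x | <ᵇ-true z<y | <ᵇ-true (<-trans z<y y<x)
        | <ᵇ-false (<⇒≤ y<x) | <ᵇ-false (<⇒≤ z<y) | <ᵇ-false (<⇒≤ (<-trans z<y y<x)) = _

isort-123 : ∀ {x y z} → x < y → y < z → isort (x ∷ y ∷ z ∷ []) ≡ x ∷ y ∷ z ∷ []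
isort-123 x<y y<z rewrite <ᵇ-true y<z | <ᵇ-true x<y = refl

isort-321 : ∀ {x y z} → y < x → z < y → isort (x ∷ y ∷ z ∷ []) ≡ z ∷ y ∷ x ∷ []
isort-321 y<x z<y rewrite <ᵇ-false (<⇒≤ z<y) | <ᵇ-false (<⇒≤ (<-trans z<y y<x)) | <ᵇ-false (<⇒≤ y<x) = refl

Distinct : ℕ → ℕ → ℕ → ℕ → ℕ → Set
Distinct n x y z v = InRange n v × v ≢ x × v ≢ y × v ≢ z

reorder : ∀ {n x y z v} → Distinct n x y z v → Distinct n z y x v
reorder (r , v≢x , v≢y , v≢z) = r , v≢z , v≢y , v≢x

module Bands {n v₁ v₂ v₃ : ℕ} (v₁<v₂ : v₁ < v₂) (v₂<v₃ : v₂ < v₃) where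

  B : ℕ → ℕ → Set
  B = InBand n (v₁ ∷ v₂ ∷ v₃ ∷ [])

  Fresh : ℕ → Set
  Fresh = Distinct n v₁ v₂ v₃

  above-low-bands⇔ : ∀ {v} → Fresh v → (¬ B 0 v × ¬ B 1 v × ¬ B 2 v) ⇔ v₃ < v
  above-low-bands⇔ {v} ((1≤v , _) , v≢v₁ , v≢v₂ , v≢v₃) = mk⇔ to from
    where
    to : ¬ B 0 v × ¬ B 1 v × ¬ B 2 v → v₃ < v
    to (¬b₀ , ¬b₁ , ¬b₂) with <-cmp v v₁ | <-cmp v v₂ | <-cmp v v₃
    ... | tri< v<v₁ _ _ | _ | _ = contradiction (1≤v , v<v₁) ¬b₀
    ... | tri≈ _ v≡v₁ _ | _ | _ = contradiction v≡v₁ v≢v₁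
    ... | tri> _ _ v₁<v | tri< v<v₂ _ _ | _ = contradiction (v₁<v , v<v₂) ¬b₁
    ... | tri> _ _ _ | tri≈ _ v≡v₂ _ | _ = contradiction v≡v₂ v≢v₂
    ... | tri> _ _ _ | tri> _ _ v₂<v | tri< v<v₃ _ _ = contradiction (v₂<v , v<v₃) ¬b₂
    ... | tri> _ _ _ | tri> _ _ _ | tri≈ _ v≡v₃ _ = contradiction v≡v₃ v≢v₃
    ... | tri> _ _ _ | tri> _ _ _ | tri> _ _ v₃<v = v₃<v
    from : v₃ < v → ¬ B 0 v × ¬ B 1 v × ¬ B 2 v
    from v₃<v = (λ (_ , v<v₁) → <-asym v₃<v (<-trans v<v₁ (<-trans v₁<v₂ v₂<v₃)))
              , (λ (_ , v<v₂) → <-asym v₃<v (<-trans v<v₂ v₂<v₃))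
              , (λ (_ , v<v₃) → <-asym v₃<v v<v₃)

  below-top-band⇔ : ∀ {v} → Fresh v → (¬ B 3 v) ⇔ v < v₃
  below-top-band⇔ {v} ((_ , v≤n) , _ , _ , v≢v₃) = mk⇔
    (λ ¬b₃ → ≤∧≢⇒< (≮⇒≥ (λ v₃<v → ¬b₃ (v₃<v , s≤s v≤n))) v≢v₃)
    (λ v<v₃ (v₃<v , _) → <-asym v<v₃ v₃<v)

  below-high-bands⇔ : ∀ {v} → Fresh v → (¬ B 1 v × ¬ B 2 v × ¬ B 3 v) ⇔ v < v₁
  below-high-bands⇔ {v} ((_ , v≤n) , v≢v₁ , v≢v₂ , v≢v₃) = mk⇔ to from
    where
    to : ¬ B 1 v × ¬ B 2 v × ¬ B 3 v → v < v₁
    to (¬b₁ , ¬b₂ , ¬b₃) with <-cmp v v₁ | <-cmp v v₂ | <-cmp v v₃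
    ... | tri< v<v₁ _ _ | _ | _ = v<v₁
    ... | tri≈ _ v≡v₁ _ | _ | _ = contradiction v≡v₁ v≢v₁
    ... | tri> _ _ v₁<v | tri< v<v₂ _ _ | _ = contradiction (v₁<v , v<v₂) ¬b₁
    ... | tri> _ _ _ | tri≈ _ v≡v₂ _ | _ = contradiction v≡v₂ v≢v₂
    ... | tri> _ _ _ | tri> _ _ v₂<v | tri< v<v₃ _ _ = contradiction (v₂<v , v<v₃) ¬b₂
    ... | tri> _ _ _ | tri> _ _ _ | tri≈ _ v≡v₃ _ = contradiction v≡v₃ v≢v₃
    ... | tri> _ _ _ | tri> _ _ _ | tri> _ _ v₃<v = contradiction (v₃<v , s≤s v≤n) ¬b₃
    from : v < v₁ → ¬ B 1 v × ¬ B 2 v × ¬ B 3 v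
    from v<v₁ = (λ (v₁<v , _) → <-asym v<v₁ v₁<v)
              , (λ (v₂<v , _) → <-asym v<v₁ (<-trans v₁<v₂ v₂<v))
              , (λ (v₃<v , _) → <-asym v<v₁ (<-trans v₁<v₂ (<-trans v₂<v₃ v₃<v)))

  above-bottom-band⇔ : ∀ {v} → Fresh v → (¬ B 0 v) ⇔ v₁ < v
  above-bottom-band⇔ {v} ((1≤v , _) , v≢v₁ , _ , _) = mk⇔
    (λ ¬b₀ → ≤∧≢⇒< (≮⇒≥ (λ v<v₁ → ¬b₀ (1≤v , v<v₁))) (v≢v₁ ∘ sym))
    (λ v₁<v (_ , v<v₁) → <-asym v<v₁ v₁<v)

module _ {P₀ P₁ P₂ P₃ : ℕ → Set} {x y z : ℕ} where

  Three-map : ∀ {Q₀ Q₁ Q₂ Q₃ : ℕ → Set} {π} →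
    (∀ {v} → P₀ v → Q₀ v) → (∀ {v} → P₁ v → Q₁ v) → (∀ {v} → P₂ v → Q₂ v) → (∀ {v} → P₃ v → Q₃ v) →
    Three P₀ P₁ P₂ P₃ x y z π → Three Q₀ Q₁ Q₂ Q₃ x y z π
  Three-map f₀ f₁ f₂ f₃ = Cut-map f₀ (Cut-map f₁ (Cut-map f₂ (All.map f₃)))


  All-segments : (ℕ → Set) → ∀ {π} → Three P₀ P₁ P₂ P₃ x y z π → Set
  All-segments Q c = All Q (segment c 0) × All Q (segment c 1) × All Q (segment c 2) × All Q (segment c 3)

  segments-distinct : ∀ {n π} → IsPerm n π → (c : Three P₀ P₁ P₂ P₃ x y z π) →
                      All-segments (Distinct (length π) x y z) c
  segments-distinct (isPerm π! refl inR) (cut {A₀} {R₀} refl _ (cut {A₁} {R₁} refl _ (cut {A₂} {A₃} refl _ _)))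
    with x≢R₀ ∷ R₀! ← unique-++ʳ A₀ π!
    with y≢R₁ ∷ R₁! ← unique-++ʳ A₁ R₀!
    with z≢A₃ ∷ _   ← unique-++ʳ A₂ R₁!
    = All.tabulate distinct₀ , All.tabulate distinct₁ , All.tabulate distinct₂ , All.tabulate distinct₃
    where
    π = A₀ ++ x ∷ R₀
    ≢ : ∀ {w R} → All (w ≢_) R → ∀ {v} → v ∈ R → v ≢ w
    ≢ w≢R v∈R v≡w = All.lookup w≢R v∈R (sym v≡w)
    y∈R₀ : y ∈ R₀
    y∈R₀ = ∈-++⁺ʳ A₁ (here refl)
    z∈R₁ : z ∈ R₁
    z∈R₁ = ∈-++⁺ʳ A₂ (here refl)
    R₁⊆R₀ : ∀ {v} → v ∈ R₁ → v ∈ R₀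
    R₁⊆R₀ = ∈-++⁺ʳ A₁ ∘ there
    inRange : ∀ {v} → v ∈ π → InRange _ v
    inRange = All.lookup inR
    distinct₀ : ∀ {v} → v ∈ A₀ → Distinct _ x y z v
    distinct₀ v∈ = let v∉ = unique-++-disjoint π! v∈ in
      inRange (∈-++⁺ˡ v∈) , (v∉ ∘ here) ,
      (v∉ ∘ there ∘ λ { refl → y∈R₀ }) , (v∉ ∘ there ∘ λ { refl → R₁⊆R₀ z∈R₁ })
    distinct₁ : ∀ {v} → v ∈ A₁ → Distinct _ x y z v
    distinct₁ v∈ = let v∉ = unique-++-disjoint R₀! v∈ in
      inRange (∈-++⁺ʳ A₀ (there (∈-++⁺ˡ v∈))) , ≢ x≢R₀ (∈-++⁺ˡ v∈) ,
      (v∉ ∘ here) , (v∉ ∘ there ∘ λ { refl → z∈R₁ })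
    distinct₂ : ∀ {v} → v ∈ A₂ → Distinct _ x y z v
    distinct₂ v∈ = let v∉ = unique-++-disjoint R₁! v∈ in
      inRange (∈-++⁺ʳ A₀ (there (R₁⊆R₀ (∈-++⁺ˡ v∈)))) , ≢ x≢R₀ (R₁⊆R₀ (∈-++⁺ˡ v∈)) ,
      ≢ y≢R₁ (∈-++⁺ˡ v∈) , (v∉ ∘ here)
    distinct₃ : ∀ {v} → v ∈ A₃ → Distinct _ x y z v
    distinct₃ v∈ = let v∈R₁ = ∈-++⁺ʳ A₂ (there v∈) in
      inRange (∈-++⁺ʳ A₀ (there (R₁⊆R₀ v∈R₁))) , ≢ x≢R₀ (R₁⊆R₀ v∈R₁) , ≢ y≢R₁ v∈R₁ , ≢ z≢A₃ v∈

  All-segments-map : ∀ {Q Q′ : ℕ → Set} {π} (c : Three P₀ P₁ P₂ P₃ x y z π) →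
                     (∀ {v} → Q v → Q′ v) → All-segments Q c → All-segments Q′ c
  All-segments-map _ f (a₀ , a₁ , a₂ , a₃) = All.map f a₀ , All.map f a₁ , All.map f a₂ , All.map f a₃

  with-segments : ∀ {π} (c : Three U U U U x y z π) → All P₀ (segment c 0) → All P₁ (segment c 1) →
                  All P₂ (segment c 2) → All P₃ (segment c 3) → Three P₀ P₁ P₂ P₃ x y z π
  with-segments (cut eq₀ _ (cut eq₁ _ (cut eq₂ _ _))) a₀ a₁ a₂ a₃ = cut eq₀ a₀ (cut eq₁ a₁ (cut eq₂ a₂ a₃))

module _ {x y z : ℕ} {π : List ℕ} where

  occurrence⇔ : ∀ {τ R} (c : Three U U U U x y z π) →
    T (isOccurrence (mesh τ R) π (positions c)) ⇔ (T (orderIso (x ∷ y ∷ z ∷ []) τ) × T (all (boxEmpty π (positions c)) R))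
  occurrence⇔ {τ} {R} c = mk⇔
    (λ t → let (o , b) = Equivalence.to T-∧ t in subst (λ σ → T (orderIso σ τ)) (at-positions c) o , b)
    (λ (o , b) → Equivalence.from T-∧ (subst (λ σ → T (orderIso σ τ)) (sym (at-positions c)) o , b))

  forget : ∀ {P₀ P₁ P₂ P₃} → Three P₀ P₁ P₂ P₃ x y z π → Three U U U U x y z π
  forget = Three-map _ _ _ _

  module Boxes {v₁ v₂ v₃ : ℕ} (v₁<v₂ : v₁ < v₂) (v₂<v₃ : v₂ < v₃) (c : Three U U U U x y z π)
               (sorted : isort (x ∷ y ∷ z ∷ []) ≡ v₁ ∷ v₂ ∷ v₃ ∷ []) where
    open Bands {length π} v₁<v₂ v₂<v₃

    box : ∀ a b → a ≤ 3 → T (boxEmpty π (positions c) (a , b)) ⇔ All (λ v → ¬ B b v) (segment c a)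
    box a b a≤3 = subst (λ vs → T (boxEmpty π (positions c) (a , b)) ⇔ All (λ v → ¬ InBand (length π) vs b v) (segment c a))
                        sorted (box⇔ c a b a≤3)

    All⇔ : ∀ {P Q : ℕ → Set} {A} → All Fresh A → (∀ {v} → Fresh v → P v ⇔ Q v) → All P A ⇔ All Q A
    All⇔ frA P⇔Q = mk⇔
      (λ PA → All.zipWith (λ (fr , p) → Equivalence.to (P⇔Q fr) p) (frA , PA))
      (λ QA → All.zipWith (λ (fr , q) → Equivalence.from (P⇔Q fr) q) (frA , QA))

    zip₃⇔ : ∀ {P Q R : ℕ → Set} {A} → (All P A × All Q A × All R A) ⇔ All (λ v → P v × Q v × R v) A
    zip₃⇔ = mk⇔ (λ (p , q , r) → All.zip (p , All.zip (q , r)))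
                (λ pqr → let (p , qr) = All.unzip pqr; (q , r) = All.unzip qr in p , q , r)

    Box : ℕ → ℕ → Set
    Box a b = T (boxEmpty π (positions c) (a , b))

    low⇔ : ∀ a → a ≤ 3 → All Fresh (segment c a) → (Box a 0 × Box a 1 × Box a 2) ⇔ All (v₃ <_) (segment c a)
    low⇔ a a≤3 fr =
      ⇔.trans (box a 0 a≤3 ×-⇔ box a 1 a≤3 ×-⇔ box a 2 a≤3) (⇔.trans zip₃⇔ (All⇔ fr above-low-bands⇔))

    high⇔ : ∀ a → a ≤ 3 → All Fresh (segment c a) → (Box a 1 × Box a 2 × Box a 3) ⇔ All (_< v₁) (segment c a)
    high⇔ a a≤3 fr =
      ⇔.trans (box a 1 a≤3 ×-⇔ box a 2 a≤3 ×-⇔ box a 3 a≤3) (⇔.trans zip₃⇔ (All⇔ fr below-high-bands⇔))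

    boxes-R₃⇔ : All-segments Fresh c → T (all (boxEmpty π (positions c)) R₃) ⇔
      (All (v₃ <_) (segment c 0) × All (v₃ <_) (segment c 1) × All (v₃ <_) (segment c 2) × All (_< v₃) (segment c 3))
    boxes-R₃⇔ (fr₀ , fr₁ , fr₂ , fr₃) = ⇔.trans (T-all _ R₃) (mk⇔ to from)
      where
      low₀ = low⇔ 0 z≤n fr₀
      low₁ = low⇔ 1 (s≤s z≤n) fr₁
      low₂ = low⇔ 2 (s≤s (s≤s z≤n)) fr₂
      top₃ = ⇔.trans (box 3 3 ≤-refl) (All⇔ fr₃ below-top-band⇔)
      to : All (T ∘ boxEmpty π (positions c)) R₃ → _
      to (b₀₀ ∷ b₀₁ ∷ b₀₂ ∷ b₁₀ ∷ b₁₁ ∷ b₁₂ ∷ b₂₀ ∷ b₂₁ ∷ b₂₂ ∷ b₃₃ ∷ []) =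
        Equivalence.to low₀ (b₀₀ , b₀₁ , b₀₂) , Equivalence.to low₁ (b₁₀ , b₁₁ , b₁₂) ,
        Equivalence.to low₂ (b₂₀ , b₂₁ , b₂₂) , Equivalence.to top₃ b₃₃
      from : _ → All (T ∘ boxEmpty π (positions c)) R₃
      from (a₀ , a₁ , a₂ , a₃) =
        let (b₀₀ , b₀₁ , b₀₂) = Equivalence.from low₀ a₀
            (b₁₀ , b₁₁ , b₁₂) = Equivalence.from low₁ a₁
            (b₂₀ , b₂₁ , b₂₂) = Equivalence.from low₂ a₂
        in b₀₀ ∷ b₀₁ ∷ b₀₂ ∷ b₁₀ ∷ b₁₁ ∷ b₁₂ ∷ b₂₀ ∷ b₂₁ ∷ b₂₂ ∷
           Equivalence.from top₃ a₃ ∷ []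

    boxes-R₄⇔ : All-segments Fresh c → T (all (boxEmpty π (positions c)) R₄) ⇔
      (All (v₁ <_) (segment c 0) × All (_< v₁) (segment c 1) × All (_< v₁) (segment c 2) × All (_< v₁) (segment c 3))
    boxes-R₄⇔ (fr₀ , fr₁ , fr₂ , fr₃) = ⇔.trans (T-all _ R₄) (mk⇔ to from)
      where
      bottom₀ = ⇔.trans (box 0 0 z≤n) (All⇔ fr₀ above-bottom-band⇔)
      high₁ = high⇔ 1 (s≤s z≤n) fr₁
      high₂ = high⇔ 2 (s≤s (s≤s z≤n)) fr₂
      high₃ = high⇔ 3 ≤-refl fr₃
      to : All (T ∘ boxEmpty π (positions c)) R₄ → _
      to (b₀₀ ∷ b₁₁ ∷ b₁₂ ∷ b₁₃ ∷ b₂₁ ∷ b₂₂ ∷ b₂₃ ∷ b₃₁ ∷ b₃₂ ∷ b₃₃ ∷ []) =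
        Equivalence.to bottom₀ b₀₀ , Equivalence.to high₁ (b₁₁ , b₁₂ , b₁₃) ,
        Equivalence.to high₂ (b₂₁ , b₂₂ , b₂₃) , Equivalence.to high₃ (b₃₁ , b₃₂ , b₃₃)
      from : _ → All (T ∘ boxEmpty π (positions c)) R₄
      from (a₀ , a₁ , a₂ , a₃) =
        let (b₁₁ , b₁₂ , b₁₃) = Equivalence.from high₁ a₁
            (b₂₁ , b₂₂ , b₂₃) = Equivalence.from high₂ a₂
            (b₃₁ , b₃₂ , b₃₃) = Equivalence.from high₃ a₃
        in Equivalence.from bottom₀ a₀ ∷
           b₁₁ ∷ b₁₂ ∷ b₁₃ ∷ b₂₁ ∷ b₂₂ ∷ b₂₃ ∷ b₃₁ ∷ b₃₂ ∷ b₃₃ ∷ []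

module _ {a b c′ : ℕ} {R : List (ℕ × ℕ)} {n : ℕ} {π : List ℕ}
         (Ord : ℕ → ℕ → ℕ → Set) (P₀ P₁ P₂ P₃ : ℕ → ℕ → ℕ → ℕ → Set)
         (orderIso⇔ : ∀ {x y z} → T (orderIso (x ∷ y ∷ z ∷ []) (a ∷ b ∷ c′ ∷ [])) ⇔ Ord x y z)
         (boxes⇔ : ∀ {x y z} → Ord x y z → (c : Three U U U U x y z π) → All-segments (Distinct (length π) x y z) c →
                   T (all (boxEmpty π (positions c)) R) ⇔
                   (All (P₀ x y z) (segment c 0) × All (P₁ x y z) (segment c 1) ×
                    All (P₂ x y z) (segment c 2) × All (P₃ x y z) (segment c 3)))
         (π-perm : IsPerm n π) where

  contains⇔shape : T (contains (mesh (a ∷ b ∷ c′ ∷ []) R) π) ⇔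
    ∃ λ ((x , y , z) : ℕ × ℕ × ℕ) → Ord x y z × Three (P₀ x y z) (P₁ x y z) (P₂ x y z) (P₃ x y z) x y z π
  contains⇔shape = mk⇔ to from
    where
    to : T (contains (mesh (a ∷ b ∷ c′ ∷ []) R) π) → _
    to t with (x , y , z) , c , occ ← Equivalence.to (contains⇔cut {a} {b} {c′} {R} {π}) t =
      let (ord , boxes) = Equivalence.to (occurrence⇔ {τ = a ∷ b ∷ c′ ∷ []} {R} c) occ
          xyz = Equivalence.to orderIso⇔ ord
          (a₀ , a₁ , a₂ , a₃) = Equivalence.to (boxes⇔ xyz c (segments-distinct π-perm c)) boxes
      in (x , y , z) , xyz , with-segments c a₀ a₁ a₂ a₃
    from : _ → T (contains (mesh (a ∷ b ∷ c′ ∷ []) R) π)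
    from ((x , y , z) , xyz , three@(cut _ a₀ (cut _ a₁ (cut _ a₂ a₃)))) =
      let c = forget three
          boxes = Equivalence.from (boxes⇔ xyz c (segments-distinct π-perm c)) (a₀ , a₁ , a₂ , a₃)
      in Equivalence.from (contains⇔cut {a} {b} {c′} {R} {π})
           ((x , y , z) , c ,
            Equivalence.from (occurrence⇔ {τ = a ∷ b ∷ c′ ∷ []} {R} c) (Equivalence.from orderIso⇔ xyz , boxes))

orderIso-123⇔ : ∀ {x y z} → T (orderIso (x ∷ y ∷ z ∷ []) p123) ⇔ (x < y × y < z)
orderIso-123⇔ = mk⇔ orderIso-123⁻ (uncurry orderIso-123⁺)

orderIso-321⇔ : ∀ {x y z} → T (orderIso (x ∷ y ∷ z ∷ []) p321) ⇔ (y < x × z < y)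
orderIso-321⇔ = mk⇔ orderIso-321⁻ (uncurry orderIso-321⁺)

contains-123R₃⇔ : ∀ {n π} → IsPerm n π → T (contains (mesh p123 R₃) π) ⇔
  ∃ λ ((x , y , z) : ℕ × ℕ × ℕ) → (x < y × y < z) × Three (z <_) (z <_) (z <_) (_< z) x y z π
contains-123R₃⇔ {n} {π} = contains⇔shape {1} {2} {3} {R₃} {n} {π}
  (λ x y z → x < y × y < z) (λ _ _ z → z <_) (λ _ _ z → z <_) (λ _ _ z → z <_) (λ _ _ z → _< z) orderIso-123⇔
  λ (x<y , y<z) c → Boxes.boxes-R₃⇔ x<y y<z c (isort-123 x<y y<z)

contains-321R₃⇔ : ∀ {n π} → IsPerm n π → T (contains (mesh p321 R₃) π) ⇔
  ∃ λ ((x , y , z) : ℕ × ℕ × ℕ) → (y < x × z < y) × Three (x <_) (x <_) (x <_) (_< x) x y z π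
contains-321R₃⇔ {n} {π} = contains⇔shape {3} {2} {1} {R₃} {n} {π}
  (λ x y z → y < x × z < y) (λ x _ _ → x <_) (λ x _ _ → x <_) (λ x _ _ → x <_) (λ x _ _ → _< x) orderIso-321⇔
  λ (y<x , z<y) c d → Boxes.boxes-R₃⇔ z<y y<x c (isort-321 y<x z<y) (All-segments-map c reorder d)

contains-123R₄⇔ : ∀ {n π} → IsPerm n π → T (contains (mesh p123 R₄) π) ⇔
  ∃ λ ((x , y , z) : ℕ × ℕ × ℕ) → (x < y × y < z) × Three (x <_) (_< x) (_< x) (_< x) x y z π
contains-123R₄⇔ {n} {π} = contains⇔shape {1} {2} {3} {R₄} {n} {π}
  (λ x y z → x < y × y < z) (λ x _ _ → x <_) (λ x _ _ → _< x) (λ x _ _ → _< x) (λ x _ _ → _< x) orderIso-123⇔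
  λ (x<y , y<z) c → Boxes.boxes-R₄⇔ x<y y<z c (isort-123 x<y y<z)

contains-321R₄⇔ : ∀ {n π} → IsPerm n π → T (contains (mesh p321 R₄) π) ⇔
  ∃ λ ((x , y , z) : ℕ × ℕ × ℕ) → (y < x × z < y) × Three (z <_) (_< z) (_< z) (_< z) x y z π
contains-321R₄⇔ {n} {π} = contains⇔shape {3} {2} {1} {R₄} {n} {π}
  (λ x y z → y < x × z < y) (λ _ _ z → z <_) (λ _ _ z → _< z) (λ _ _ z → _< z) (λ _ _ z → _< z) orderIso-321⇔
  λ (y<x , z<y) c d → Boxes.boxes-R₄⇔ z<y y<x c (isort-321 y<x z<y) (All-segments-map c reorder d)


-- Symmetries and the theorem

All-reverse : ∀ {P : ℕ → Set} {A} → All P A → All P (reverse A)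
All-reverse {A = A} = All-resp-↭ (↭-sym (↭-reverse A))

unique-reverse : ∀ {xs : List ℕ} → Unique xs → Unique (reverse xs)
unique-reverse {[]}     []          = []
unique-reverse {x ∷ xs} (x≢ ∷ xs!) = subst Unique (sym (unfold-reverse x xs))
  (Unique.++⁺ (unique-reverse xs!) ([] ∷ []) λ { (v∈ , here v≡x) → All.lookup x≢ (Any.reverse⁻ v∈) (sym v≡x) })

reverse-isPerm : ∀ {n π} → IsPerm n π → IsPerm n (reverse π)
reverse-isPerm {π = π} (isPerm π! len inR) = isPerm (unique-reverse π!) (trans (length-reverse π) len) (All-reverse inR)

reverse-∷ : ∀ (A : List ℕ) x B → reverse (A ++ x ∷ B) ≡ reverse B ++ x ∷ reverse A
reverse-∷ A x B = begin
  reverse (A ++ x ∷ B)              ≡⟨ reverse-++ A (x ∷ B) ⟩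
  reverse (x ∷ B) ++ reverse A      ≡⟨ cong (_++ reverse A) (unfold-reverse x B) ⟩
  (reverse B ++ x ∷ []) ++ reverse A ≡⟨ ++-assoc (reverse B) (x ∷ []) (reverse A) ⟩
  reverse B ++ x ∷ reverse A        ∎
  where open ≡-Reasoning

Three-reverse : ∀ {P₀ P₁ P₂ P₃ : ℕ → Set} {x y z π} →
  Three P₀ P₁ P₂ P₃ x y z π → Three P₃ P₂ P₁ P₀ z y x (reverse π)
Three-reverse {x = x} {y} {z} (cut {A₀} refl a₀ (cut {A₁} refl a₁ (cut {A₂} {A₃} refl a₂ a₃))) =
  cut π′≡ (All-reverse a₃) (cut refl (All-reverse a₂) (cut refl (All-reverse a₁) (All-reverse a₀)))
  where
  open ≡-Reasoning
  π′≡ : reverse (A₀ ++ x ∷ A₁ ++ y ∷ A₂ ++ z ∷ A₃) ≡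
        reverse A₃ ++ z ∷ reverse A₂ ++ y ∷ reverse A₁ ++ x ∷ reverse A₀
  π′≡ = begin
    reverse (A₀ ++ x ∷ A₁ ++ y ∷ A₂ ++ z ∷ A₃)
      ≡⟨ reverse-∷ A₀ x _ ⟩
    reverse (A₁ ++ y ∷ A₂ ++ z ∷ A₃) ++ x ∷ reverse A₀
      ≡⟨ cong (_++ x ∷ reverse A₀) (reverse-∷ A₁ y _) ⟩
    (reverse (A₂ ++ z ∷ A₃) ++ y ∷ reverse A₁) ++ x ∷ reverse A₀
      ≡⟨ ++-assoc (reverse (A₂ ++ z ∷ A₃)) _ _ ⟩
    reverse (A₂ ++ z ∷ A₃) ++ y ∷ reverse A₁ ++ x ∷ reverse A₀
      ≡⟨ cong (_++ y ∷ reverse A₁ ++ x ∷ reverse A₀) (reverse-∷ A₂ z A₃) ⟩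
    (reverse A₃ ++ z ∷ reverse A₂) ++ y ∷ reverse A₁ ++ x ∷ reverse A₀
      ≡⟨ ++-assoc (reverse A₃) _ _ ⟩
    reverse A₃ ++ z ∷ reverse A₂ ++ y ∷ reverse A₁ ++ x ∷ reverse A₀
      ∎

Three-mapᶠ : ∀ {R P₀ P₁ P₂ P₃ Q₀ Q₁ Q₂ Q₃ : ℕ → Set} {x y z π} (f : ℕ → ℕ) → All R π →
  (∀ {v} → R v → P₀ v → Q₀ (f v)) → (∀ {v} → R v → P₁ v → Q₁ (f v)) →
  (∀ {v} → R v → P₂ v → Q₂ (f v)) → (∀ {v} → R v → P₃ v → Q₃ (f v)) →
  Three P₀ P₁ P₂ P₃ x y z π → Three Q₀ Q₁ Q₂ Q₃ (f x) (f y) (f z) (map f π)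
Three-mapᶠ {R} {x = x} {y} {z} f Rπ g₀ g₁ g₂ g₃ (cut {A₀} refl a₀ (cut {A₁} refl a₁ (cut {A₂} {A₃} refl a₂ a₃)))
  with R₀ , _ ∷ R-rest₀ ← All.++⁻ A₀ Rπ
  with R₁ , _ ∷ R-rest₁ ← All.++⁻ A₁ R-rest₀
  with R₂ , _ ∷ R₃      ← All.++⁻ A₂ R-rest₁
  = cut (map-++ f A₀ _) (mapᴬ g₀ R₀ a₀)
   (cut (map-++ f A₁ _) (mapᴬ g₁ R₁ a₁)
   (cut (map-++ f A₂ _) (mapᴬ g₂ R₂ a₂) (mapᴬ g₃ R₃ a₃)))
  where
  mapᴬ : ∀ {P Q : ℕ → Set} {A} → (∀ {v} → R v → P v → Q (f v)) → All R A → All P A → All Q (map f A)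
  mapᴬ g RA PA = All.map⁺ (All.zipWith (λ (r , p) → g r p) (RA , PA))

complement : ℕ → List ℕ → List ℕ
complement n = map (suc n ∸_)

complement-inRange : ∀ {n v} → InRange n v → InRange n (suc n ∸ v)
complement-inRange {n} {suc v} (_ , v<n) = m<n⇒0<n∸m (s≤s v<n) , m∸n≤m n v

complement-involutive : ∀ {n π} → All (InRange n) π → complement n (complement n π) ≡ π
complement-involutive {n} {π} inR =
  trans (sym (map-∘ π)) (map-id-local (All.map (λ (_ , v≤n) → m∸[m∸n]≡n (m≤n⇒m≤1+n v≤n)) inR))

complement-isPerm : ∀ {n π} → IsPerm n π → IsPerm n (complement n π)
complement-isPerm {n} {π} (isPerm π! len inR) =
  isPerm (unique-map-injectiveOn injective π!) (trans (length-map _ π) len) (All.map⁺ (All.map complement-inRange inR))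
  where
  injective : ∀ {a b} → a ∈ π → b ∈ π → suc n ∸ a ≡ suc n ∸ b → a ≡ b
  injective {a} {b} a∈ b∈ eq = begin
    a                          ≡⟨ sym (m∸[m∸n]≡n (m≤n⇒m≤1+n (proj₂ (All.lookup inR a∈)))) ⟩
    suc n ∸ (suc n ∸ a)        ≡⟨ cong (suc n ∸_) eq ⟩
    suc n ∸ (suc n ∸ b)        ≡⟨ m∸[m∸n]≡n (m≤n⇒m≤1+n (proj₂ (All.lookup inR b∈))) ⟩
    b                          ∎
    where open ≡-Reasoning

Three-pivots : ∀ {Q P₀ P₁ P₂ P₃ : ℕ → Set} {x y z π} → All Q π → Three P₀ P₁ P₂ P₃ x y z π →
               Q x × Q y × Q z
Three-pivots Qπ (cut {A₀} refl _ (cut {A₁} refl _ (cut {A₂} refl _ _)))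
  with _ , Qx ∷ Q₀ ← All.++⁻ A₀ Qπ
  with _ , Qy ∷ Q₁ ← All.++⁻ A₁ Q₀
  with _ , Qz ∷ _  ← All.++⁻ A₂ Q₁
  = Qx , Qy , Qz

flip-above : ∀ {n t v} → InRange n v → t < v → suc n ∸ v < suc n ∸ t
flip-above (_ , v≤n) t<v = ∸-monoʳ-< t<v (m≤n⇒m≤1+n v≤n)

flip-below : ∀ {n t v} → InRange n t → v < t → suc n ∸ t < suc n ∸ v
flip-below (_ , t≤n) v<t = ∸-monoʳ-< v<t (m≤n⇒m≤1+n t≤n)

module _ {n π} (P : IsPerm n π) where
  open IsPerm P

  contains-123R₃⇔Occ : T (contains (mesh p123 R₃) π) ⇔ Occ₁₂₃ (reverse π)
  contains-123R₃⇔Occ = ⇔.trans (contains-123R₃⇔ P) (mk⇔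
    (λ ((x , y , z) , (x<y , y<z) , t) → (z , y , x) , (x<y , y<z) , Three-reverse t)
    (λ ((s , q , p) , (p<q , q<s) , t) → (p , q , s) , (p<q , q<s) ,
       subst (Three (s <_) (s <_) (s <_) (_< s) p q s) (reverse-involutive π) (Three-reverse t)))

  contains-321R₃⇔Occ : T (contains (mesh p321 R₃) π) ⇔ Occ₃₂₁ (reverse π)
  contains-321R₃⇔Occ = ⇔.trans (contains-321R₃⇔ P) (mk⇔
    (λ ((x , y , z) , (y<x , z<y) , t) → (z , y , x) , (z<y , y<x) , Three-reverse t)
    (λ ((s , b , c) , (s<b , b<c) , t) → (c , b , s) , (b<c , s<b) ,
       subst (Three (c <_) (c <_) (c <_) (_< c) c b s) (reverse-involutive π) (Three-reverse t)))

  private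
    comp = suc n ∸_
    inRange′ = IsPerm.inRange (complement-isPerm P)

  contains-123R₄⇔Occ : T (contains (mesh p123 R₄) π) ⇔ Occ₁₂₃ (complement n π)
  contains-123R₄⇔Occ = ⇔.trans (contains-123R₄⇔ P) (mk⇔ to from)
    where
    to : _ → Occ₁₂₃ (complement n π)
    to ((x , y , z) , (x<y , y<z) , t) with rx , ry , rz ← Three-pivots inRange t =
      (comp x , comp y , comp z) , (flip-below rz y<z , flip-below ry x<y) ,
      Three-mapᶠ comp inRange flip-above (λ _ → flip-below rx) (λ _ → flip-below rx) (λ _ → flip-below rx) t
    from : Occ₁₂₃ (complement n π) → _
    from ((s , q , p) , (p<q , q<s) , t) with rs , rq , rp ← Three-pivots inRange′ t =
      (comp s , comp q , comp p) , (flip-below rs q<s , flip-below rq p<q) ,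
      subst (Three (comp s <_) (_< comp s) (_< comp s) (_< comp s) (comp s) (comp q) (comp p))
            (complement-involutive inRange)
            (Three-mapᶠ comp inRange′ (λ _ → flip-below rs) flip-above flip-above flip-above t)

  contains-321R₄⇔Occ : T (contains (mesh p321 R₄) π) ⇔ Occ₃₂₁ (complement n π)
  contains-321R₄⇔Occ = ⇔.trans (contains-321R₄⇔ P) (mk⇔ to from)
    where
    to : _ → Occ₃₂₁ (complement n π)
    to ((x , y , z) , (y<x , z<y) , t) with rx , ry , rz ← Three-pivots inRange t =
      (comp x , comp y , comp z) , (flip-below rx y<x , flip-below ry z<y) ,
      Three-mapᶠ comp inRange flip-above (λ _ → flip-below rz) (λ _ → flip-below rz) (λ _ → flip-below rz) t
    from : Occ₃₂₁ (complement n π) → _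
    from ((s , b , c) , (s<b , b<c) , t) with rs , rb , rc ← Three-pivots inRange′ t =
      (comp s , comp b , comp c) , (flip-below rb s<b , flip-below rc b<c) ,
      subst (Three (comp c <_) (_< comp c) (_< comp c) (_< comp c) (comp s) (comp b) (comp c))
            (complement-involutive inRange)
            (Three-mapᶠ comp inRange′ (λ _ → flip-below rc) flip-above flip-above flip-above t)

module _ {n π} (P : IsPerm n π) where
  open IsPerm using (unique)

  contains-123R₃≡ : contains (mesh p123 R₃) π ≡ scan test₁₂₃ 0 (lehmer (reverse π))
  contains-123R₃≡ = T-⇔⇒≡ (⇔.trans (contains-123R₃⇔Occ P) (⇔.sym (scan₁₂₃⇔ (unique (reverse-isPerm P)))))

  contains-321R₃≡ : contains (mesh p321 R₃) π ≡ scan test₃₂₁ 0 (lehmer (reverse π))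
  contains-321R₃≡ = T-⇔⇒≡ (⇔.trans (contains-321R₃⇔Occ P) (⇔.sym (scan₃₂₁⇔ (unique (reverse-isPerm P)))))

  contains-123R₄≡ : contains (mesh p123 R₄) π ≡ scan test₁₂₃ 0 (lehmer (complement n π))
  contains-123R₄≡ = T-⇔⇒≡ (⇔.trans (contains-123R₄⇔Occ P) (⇔.sym (scan₁₂₃⇔ (unique (complement-isPerm P)))))

  contains-321R₄≡ : contains (mesh p321 R₄) π ≡ scan test₃₂₁ 0 (lehmer (complement n π))
  contains-321R₄≡ = T-⇔⇒≡ (⇔.trans (contains-321R₄⇔Occ P) (⇔.sym (scan₃₂₁⇔ (unique (complement-isPerm P)))))

toggleπ : List ℕ → List ℕ
toggleπ π = reverse (unlehmer (toggle (lehmer (reverse π))))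

module _ {n π} (P : IsPerm n π) where

  private
    c = lehmer (reverse π)
    c-isLehmer = lehmer-isLehmer (reverse π)

  toggleπ-isPerm : IsPerm n (toggleπ π)
  toggleπ-isPerm =
    reverse-isPerm (subst (λ m → IsPerm m (unlehmer (toggle c))) length≡ (unlehmer-isPerm (toggle-isLehmer c-isLehmer)))
    where
    length≡ : length (toggle c) ≡ n
    length≡ = trans (length-toggle c) (trans (length-lehmer (reverse π)) (trans (length-reverse π) (IsPerm.length≡ P)))

  toggleπ-involutive : toggleπ (toggleπ π) ≡ π
  toggleπ-involutive = begin
    reverse (unlehmer (toggle (lehmer (reverse (reverse (unlehmer (toggle c)))))))
      ≡⟨ cong (λ σ → reverse (unlehmer (toggle (lehmer σ)))) (reverse-involutive (unlehmer (toggle c))) ⟩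
    reverse (unlehmer (toggle (lehmer (unlehmer (toggle c)))))
      ≡⟨ cong (reverse ∘ unlehmer ∘ toggle) (lehmer-unlehmer (toggle-isLehmer c-isLehmer)) ⟩
    reverse (unlehmer (toggle (toggle c)))
      ≡⟨ cong (reverse ∘ unlehmer) (toggle-involutive c-isLehmer) ⟩
    reverse (unlehmer c)
      ≡⟨ cong reverse (unlehmer-lehmer n (reverse-isPerm P)) ⟩
    reverse (reverse π)
      ≡⟨ reverse-involutive π ⟩
    π ∎
    where open ≡-Reasoning

  contains-toggleπ : contains (mesh p123 R₃) π ≡ contains (mesh p321 R₃) (toggleπ π)
  contains-toggleπ = begin
    contains (mesh p123 R₃) π
      ≡⟨ contains-123R₃≡ P ⟩
    scan test₁₂₃ 0 c
      ≡⟨ scan-toggle c-isLehmer (inj₁ refl) ⟩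
    scan test₃₂₁ 0 (toggle c)
      ≡⟨ cong (scan test₃₂₁ 0) (sym (lehmer-unlehmer (toggle-isLehmer c-isLehmer))) ⟩
    scan test₃₂₁ 0 (lehmer (unlehmer (toggle c)))
      ≡⟨ cong (scan test₃₂₁ 0 ∘ lehmer) (sym (reverse-involutive (unlehmer (toggle c)))) ⟩
    scan test₃₂₁ 0 (lehmer (reverse (toggleπ π)))
      ≡⟨ sym (contains-321R₃≡ toggleπ-isPerm) ⟩
    contains (mesh p321 R₃) (toggleπ π)
      ∎
    where open ≡-Reasoning

rotate180 : ℕ → List ℕ → List ℕ
rotate180 n π = reverse (complement n π)

module _ {n π} (P : IsPerm n π) where

  rotate180-isPerm : IsPerm n (rotate180 n π)
  rotate180-isPerm = reverse-isPerm (complement-isPerm P)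

  complement-rotate180 : complement n (rotate180 n π) ≡ reverse π
  complement-rotate180 = trans (reverse-map _ (complement n π)) (cong reverse (complement-involutive (IsPerm.inRange P)))

  rotate180-involutive : rotate180 n (rotate180 n π) ≡ π
  rotate180-involutive = trans (cong reverse complement-rotate180) (reverse-involutive π)

  contains-rotate180₁₂₃ : contains (mesh p123 R₃) π ≡ contains (mesh p123 R₄) (rotate180 n π)
  contains-rotate180₁₂₃ = trans (contains-123R₃≡ P)
    (trans (cong (scan test₁₂₃ 0 ∘ lehmer) (sym complement-rotate180)) (sym (contains-123R₄≡ rotate180-isPerm)))

  contains-rotate180₃₂₁ : contains (mesh p321 R₃) π ≡ contains (mesh p321 R₄) (rotate180 n π)
  contains-rotate180₃₂₁ = trans (contains-321R₃≡ P)
    (trans (cong (scan test₃₂₁ 0 ∘ lehmer) (sym complement-rotate180)) (sym (contains-321R₄≡ rotate180-isPerm)))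

theorem2p3 : (n : ℕ) → n ≥ 1 →
  (countAvoiders (mesh p123 R₃) n ≡ countAvoiders (mesh p321 R₃) n) ×
  (countAvoiders (mesh p321 R₃) n ≡ countAvoiders (mesh p123 R₄) n) ×
  (countAvoiders (mesh p123 R₄) n ≡ countAvoiders (mesh p321 R₄) n)
theorem2p3 n _ = 123R₃≡321R₃ , trans (sym 123R₃≡321R₃) 123R₃≡123R₄ ,
                 trans (sym 123R₃≡123R₄) (trans 123R₃≡321R₃ 321R₃≡321R₄)
  where
  123R₃≡321R₃ : countAvoiders (mesh p123 R₃) n ≡ countAvoiders (mesh p321 R₃) n
  123R₃≡321R₃ = countAvoiders-involution {n} (mesh p123 R₃) (mesh p321 R₃)
                  toggleπ toggleπ-isPerm toggleπ-involutive contains-toggleπ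
  123R₃≡123R₄ : countAvoiders (mesh p123 R₃) n ≡ countAvoiders (mesh p123 R₄) n
  123R₃≡123R₄ = countAvoiders-involution {n} (mesh p123 R₃) (mesh p123 R₄)
                  (rotate180 n) rotate180-isPerm rotate180-involutive contains-rotate180₁₂₃
  321R₃≡321R₄ : countAvoiders (mesh p321 R₃) n ≡ countAvoiders (mesh p321 R₄) n
  321R₃≡321R₄ = countAvoiders-involution {n} (mesh p321 R₃) (mesh p321 R₄)
                  (rotate180 n) rotate180-isPerm rotate180-involutive contains-rotate180₃₂₁
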